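{- For all non-negative integers $n,r,m$, \[ \sum_{k=0}^{n}(-1)^{k}\genfrac{\{}{\}}{0pt}{}{n}{k}_{m}\,k!\,h_{k+1}^{(r)}=B_{n}(m-r) \qquad\text{and}\qquad \sum_{k=0}^{n}\genfrac{[}{]}{0pt}{}{n}{k}_{m}B_{k}(r)=n!\,h_{n+1}^{(r+m-1)}. \]
   Context: For an integer $r$ (possibly negative) and an integer $n\ge0$, the hyperharmonic number $h_n^{(r)}$ is the coefficient of $t^n$ in $\frac{ -\ln(1-t)}{(1-t)^r}$; for $r\ge1$ this agrees with $h_n^{(r)}=\sum_{k=1}^n h_k^{(r-1)}$, $h_k^{(0)}=1/k$. The $r$-Stirling numbers of the first and second kind are defined by $(x+r)^{\overline{n}}=\sum_{k=0}^n\genfrac{[}{]}{0pt}{}{n}{k}_r x^k$ and $(x+r)^n=\sum_{k=0}^n\genfrac{\{}{\}}{0pt}{}{n}{k}_r (x)^{\underline{k}}$, where $(x)^{\overline{n}}=x(x+1)\cdots(x+n-1)$ and $(x)^{\underline{n}}=x(x-1)\cdots(x-n+1)$ (both equal to $1$ for $n=0$). $B_n(x)$ are the Bernoulli polynomials, $\sum_{n\ge0}B_n(x)\frac{t^n}{n!}=\frac{t e^{xt}}{e^t-1}$. -}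

module Defs where

open import Data.Nat using (ℕ; zero; suc; _∸_; _!)
open import Data.Nat.Properties using (_!≢0)
import Data.Nat as ℕ
open import Data.Nat.Combinatorics using (_C_)
open import Data.Integer using (ℤ; +_)
open import Data.List using (List; []; _∷_; _++_; [_]; foldl; upTo; zipWith)
open import Data.Rational using (ℚ; _+_; _*_; -_; _/_; 0ℚ; 1ℚ)

ℕ→ℚ : ℕ → ℚ
ℕ→ℚ n = + n / 1

ℤ→ℚ : ℤ → ℚ
ℤ→ℚ z = z / 1

_^ℚ_ : ℚ → ℕ → ℚ
x ^ℚ zero = 1ℚ
x ^ℚ suc n = x * (x ^ℚ n)

sgn : ℕ → ℚ
sgn k = (- 1ℚ) ^ℚ k

sumTo : ℕ → (ℕ → ℚ) → ℚ
sumTo zero f = f 0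
sumTo (suc n) f = sumTo n f + f (suc n)

sumBelow : ℕ → (ℕ → ℚ) → ℚ
sumBelow zero f = 0ℚ
sumBelow (suc n) f = sumBelow n f + f n

rising : ℚ → ℕ → ℚ
rising x zero = 1ℚ
rising x (suc i) = rising x i * (x + ℕ→ℚ i)

-- coefficient of t^i in (1-t)^{-r}  (r ∈ ℤ):  r^(rising i) / i!
invPowCoeff : ℤ → ℕ → ℚ
invPowCoeff r i = rising (ℤ→ℚ r) i * ((+ 1 / (i !)) ⦃ i !≢0 ⦄)

-- hyperharmonic number h_n^{(r)}: coefficient of t^n in -ln(1-t)/(1-t)^r,
-- i.e. the Cauchy product of  Σ_{j≥1} t^j / j  and  Σ_i invPowCoeff r i t^i.
hyperharmonic : ℕ → ℤ → ℚ
hyperharmonic n r = sumBelow n (λ j → (+ 1 / suc j) * invPowCoeff r (n ∸ suc j))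

-- r-Stirling numbers (parameter m), via the recurrences obtained from the
-- defining identities by multiplying with (x+m+n), resp. (x+m) = (x-k)+(k+m):
--   [n+1,k]_m = [n,k-1]_m + (n+m)[n,k]_m ,  {n+1,k}_m = {n,k-1}_m + (k+m){n,k}_m
rStirling1 : ℕ → ℕ → ℕ → ℕ
rStirling1 m zero zero = 1
rStirling1 m zero (suc k) = 0
rStirling1 m (suc n) zero = (n ℕ.+ m) ℕ.* rStirling1 m n zero
rStirling1 m (suc n) (suc k) = rStirling1 m n k ℕ.+ (n ℕ.+ m) ℕ.* rStirling1 m n (suc k)

rStirling2 : ℕ → ℕ → ℕ → ℕ
rStirling2 m zero zero = 1
rStirling2 m zero (suc k) = 0
rStirling2 m (suc n) zero = m ℕ.* rStirling2 m n zero
rStirling2 m (suc n) (suc k) = rStirling2 m n k ℕ.+ (suc k ℕ.+ m) ℕ.* rStirling2 m n (suc k)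

-- Bernoulli numbers (t/(e^t-1) convention, B_1 = -1/2):
-- B_0 = 1,  B_{n+1} = -(1/(n+2)) Σ_{k=0}^{n} C(n+2,k) B_k
bernNext : ℕ → List ℚ → ℚ
bernNext n bs = - ((+ 1 / suc (suc n)) * foldl _+_ 0ℚ
  (zipWith (λ k b → ℕ→ℚ (suc (suc n) C k) * b) (upTo (suc n)) bs))

bernList : ℕ → List ℚ
bernList zero = [ 1ℚ ]
bernList (suc n) = bernList n ++ [ bernNext n (bernList n) ]

lastOr0 : List ℚ → ℚ
lastOr0 [] = 0ℚ
lastOr0 (x ∷ []) = x
lastOr0 (x ∷ y ∷ xs) = lastOr0 (y ∷ xs)

bernoulliNumber : ℕ → ℚ
bernoulliNumber n = lastOr0 (bernList n)

-- Bernoulli polynomial: t e^{xt}/(e^t-1) = (t/(e^t-1)) e^{xt}, so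
-- B_n(x) = Σ_{k=0}^{n} C(n,k) B_k x^{n-k}
bernoulliPoly : ℕ → ℚ → ℚ
bernoulliPoly n x = sumTo n (λ k → ℕ→ℚ (n C k) * bernoulliNumber k * (x ^ℚ (n ∸ k)))

-- Let Λ_y be the linear functional on ℚ[x] with Λ_y(x^k) = B_k(y). The difference equation
-- B_k(y + 1) - B_k(y) = k y^(k-1) says Λ_y(p(x + 1)) - Λ_y(p(x)) = p′(y), and this property determines
-- the values B_k(y) by induction on k.
--
-- The second identity: its left side is Λ_r((x + m)^(n rising)), and
-- (n + 1) (x + m)^(n rising) = q(x + 1) - q(x) for q = (x + m - 1)^(n + 1 rising), so the sum is
-- q′(r) / (n + 1); and n! h_n^(z) is the derivative of t^(n rising) at t = z.
--
-- The first identity: the functional μ with μ(x^(k falling)) = (-1)^k k! h_(k+1)^(r) satisfies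
-- μ(p(x + 1)) - μ(p(x)) = p′(-r), since (k + 1) times that value is the derivative of
-- x^(k + 1 falling) at -r. Hence the left side μ((x + m)^n), viewed as a sequence in n, obeys the
-- recurrence that determines B_n(m - r).
module Submission where

open import Defs
open import Data.Nat as ℕ using (ℕ; zero; suc; _∸_; _!; NonZero; z≤n; s≤s)
import Data.Nat.Properties as ℕ
open import Data.Nat.Properties using (_!≢0; _!*_!≢0)
open import Data.Nat.Combinatorics
  using (_C_; nCk≡nC[n∸k]; nC1≡n; nCn≡1; k>n⇒nCk≡0; nCk+nC[k+1]≡[n+1]C[k+1]; nCk≡n!/k![n-k]!; k![n∸k]!∣n!)
open import Data.Nat.DivMod using (m/n*n≡m)
import Data.Nat.Coprimality as Coprimality
import Data.Nat.Solver as ℕ-Solver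
open import Data.Integer as ℤ using (ℤ; +_; -[1+_]) renaming (_+_ to _+ℤ_; _-_ to _-ℤ_)
import Data.Integer.Properties as ℤ
open import Data.Rational using (ℚ; mkℚ; _+_; _*_; -_; _-_; _/_; 0ℚ; 1ℚ)
open import Data.Rational.Properties
open import Data.Rational.Solver using (module +-*-Solver)
open import Algebra.Properties.Group +-0-group using () renaming (∙-cancelˡ to +-cancelˡ; ∙-cancelʳ to +-cancelʳ)
open import Data.List using ([]; _∷_; _∷ʳ_; foldl; upTo; zipWith; length)
import Data.List.Properties as List
open import Data.Product using (_×_; _,_)
open import Data.Sum using (inj₁; inj₂)
open import Relation.Binary.PropositionalEquality
open import Relation.Nullary using (yes; no)

open +-*-Solver
open ℕ-Solver.+-*-Solver using () renaming (solve to solveℕ; _:+_ to _⊕_; _:*_ to _⊗_; _:=_ to _⊜_; con to κ)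
open ≡-Reasoning


-- Embeddings into ℚ

ℤ→ℚ≡mkℚ : ∀ z → ℤ→ℚ z ≡ mkℚ z 0 (Coprimality.sym (Coprimality.1-coprimeTo ℤ.∣ z ∣))
ℤ→ℚ≡mkℚ (+ n) = normalize-coprime (Coprimality.sym (Coprimality.1-coprimeTo n))
ℤ→ℚ≡mkℚ -[1+ n ] = cong -_ (normalize-coprime (Coprimality.sym (Coprimality.1-coprimeTo (suc n))))

ℤ→ℚ-homo-+ : ∀ a b → ℤ→ℚ (a ℤ.+ b) ≡ ℤ→ℚ a + ℤ→ℚ b
ℤ→ℚ-homo-+ a b rewrite ℤ→ℚ≡mkℚ a | ℤ→ℚ≡mkℚ b =
  /-cong (sym (cong₂ ℤ._+_ (ℤ.*-identityʳ a) (ℤ.*-identityʳ b))) refl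

ℤ→ℚ-homo-* : ∀ a b → ℤ→ℚ (a ℤ.* b) ≡ ℤ→ℚ a * ℤ→ℚ b
ℤ→ℚ-homo-* a b rewrite ℤ→ℚ≡mkℚ a | ℤ→ℚ≡mkℚ b = refl

ℤ→ℚ-homo-neg : ∀ a → ℤ→ℚ (ℤ.- a) ≡ - ℤ→ℚ a
ℤ→ℚ-homo-neg (+ zero) = refl
ℤ→ℚ-homo-neg (+ suc n) = refl
ℤ→ℚ-homo-neg -[1+ n ] = trans (ℤ→ℚ≡mkℚ (+ suc n)) (sym (cong -_ (ℤ→ℚ≡mkℚ -[1+ n ])))

ℤ→ℚ-homo-sub : ∀ a b → ℤ→ℚ (a ℤ.- b) ≡ ℤ→ℚ a - ℤ→ℚ b
ℤ→ℚ-homo-sub a b = trans (ℤ→ℚ-homo-+ a (ℤ.- b)) (cong (_+_ (ℤ→ℚ a)) (ℤ→ℚ-homo-neg b))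

ℕ→ℚ-homo-+ : ∀ a b → ℕ→ℚ (a ℕ.+ b) ≡ ℕ→ℚ a + ℕ→ℚ b
ℕ→ℚ-homo-+ a b = trans (cong ℤ→ℚ (ℤ.pos-+ a b)) (ℤ→ℚ-homo-+ (+ a) (+ b))

ℕ→ℚ-homo-* : ∀ a b → ℕ→ℚ (a ℕ.* b) ≡ ℕ→ℚ a * ℕ→ℚ b
ℕ→ℚ-homo-* a b = trans (cong ℤ→ℚ (ℤ.pos-* a b)) (ℤ→ℚ-homo-* (+ a) (+ b))

ℕ→ℚ-suc : ∀ a → ℕ→ℚ (suc a) ≡ 1ℚ + ℕ→ℚ a
ℕ→ℚ-suc = ℕ→ℚ-homo-+ 1

ℕ→ℚ-*-inverse : ∀ d .{{_ : NonZero d}} → ℕ→ℚ d * (+ 1 / d) ≡ 1ℚ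
ℕ→ℚ-*-inverse (suc d) =
  trans (cong₂ _*_ (ℤ→ℚ≡mkℚ (+ suc d)) (normalize-coprime (Coprimality.1-coprimeTo (suc d))))
        (*-inverseʳ (mkℚ (+ suc d) 0 (Coprimality.sym (Coprimality.1-coprimeTo (suc d)))))

ℕ→ℚ-*-cancelˡ : ∀ d .{{_ : NonZero d}} {p q} → ℕ→ℚ d * p ≡ ℕ→ℚ d * q → p ≡ q
ℕ→ℚ-*-cancelˡ d {p} {q} eq = trans (sym (undo p)) (trans (cong ((+ 1 / d) *_) eq) (undo q))
  where
  undo : ∀ x → (+ 1 / d) * (ℕ→ℚ d * x) ≡ x
  undo x = begin
    (+ 1 / d) * (ℕ→ℚ d * x)  ≡⟨ solve 3 (λ e d x → e :* (d :* x) := (d :* e) :* x) refl (+ 1 / d) (ℕ→ℚ d) x ⟩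
    ℕ→ℚ d * (+ 1 / d) * x    ≡⟨ cong (_* x) (ℕ→ℚ-*-inverse d) ⟩
    1ℚ * x                   ≡⟨ *-identityˡ x ⟩
    x                        ∎


-- Finite sums

∑ : ℕ → (ℕ → ℚ) → ℚ
∑ = sumBelow

infixr 8 ∑

syntax ∑ n (λ k → e) = ∑[ k < n ] e

sumTo≡∑ : ∀ n f → sumTo n f ≡ ∑ (suc n) f
sumTo≡∑ zero f = sym (+-identityˡ (f 0))
sumTo≡∑ (suc n) f = cong (_+ f (suc n)) (sumTo≡∑ n f)

∑-cong< : ∀ n {f g : ℕ → ℚ} → (∀ k → k ℕ.< n → f k ≡ g k) → ∑ n f ≡ ∑ n g
∑-cong< zero eq = refl
∑-cong< (suc n) eq = cong₂ _+_ (∑-cong< n (λ k k<n → eq k (ℕ.m<n⇒m<1+n k<n))) (eq n ℕ.≤-refl)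

∑-cong : ∀ n {f g : ℕ → ℚ} → (∀ k → f k ≡ g k) → ∑ n f ≡ ∑ n g
∑-cong n eq = ∑-cong< n (λ k _ → eq k)

∑-zero : ∀ n → ∑[ k < n ] 0ℚ ≡ 0ℚ
∑-zero zero = refl
∑-zero (suc n) = trans (+-identityʳ _) (∑-zero n)

∑-distrib-+ : ∀ n (f g : ℕ → ℚ) → ∑[ k < n ] (f k + g k) ≡ ∑ n f + ∑ n g
∑-distrib-+ zero f g = refl
∑-distrib-+ (suc n) f g = trans (cong (_+ (f n + g n)) (∑-distrib-+ n f g))
  (solve 4 (λ a b c d → (a :+ b) :+ (c :+ d) := (a :+ c) :+ (b :+ d)) refl (∑ n f) (∑ n g) (f n) (g n))

∑-*ˡ : ∀ n c (f : ℕ → ℚ) → ∑[ k < n ] (c * f k) ≡ c * ∑ n f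
∑-*ˡ zero c f = sym (*-zeroʳ c)
∑-*ˡ (suc n) c f = trans (cong (_+ c * f n) (∑-*ˡ n c f)) (sym (*-distribˡ-+ c (∑ n f) (f n)))

∑-*ʳ : ∀ n c (f : ℕ → ℚ) → ∑[ k < n ] (f k * c) ≡ ∑ n f * c
∑-*ʳ n c f = trans (∑-cong n (λ k → *-comm (f k) c)) (trans (∑-*ˡ n c f) (*-comm c (∑ n f)))

∑-shift : ∀ n (f : ℕ → ℚ) → ∑ (suc n) f ≡ f 0 + ∑[ k < n ] f (suc k)
∑-shift zero f = trans (+-identityˡ (f 0)) (sym (+-identityʳ (f 0)))
∑-shift (suc n) f = trans (cong (_+ f (suc n)) (∑-shift n f)) (+-assoc (f 0) _ _)

∑-swap : ∀ n m (F : ℕ → ℕ → ℚ) → ∑[ i < n ] ∑[ j < m ] F i j ≡ ∑[ j < m ] ∑[ i < n ] F i j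
∑-swap zero m F = sym (∑-zero m)
∑-swap (suc n) m F = trans (cong (_+ ∑ m (F n)) (∑-swap n m F))
  (sym (∑-distrib-+ m (λ j → ∑[ i < n ] F i j) (F n)))

∑-reverse : ∀ n (f : ℕ → ℚ) → ∑ n f ≡ ∑[ k < n ] f (n ∸ suc k)
∑-reverse zero f = refl
∑-reverse (suc n) f = trans (cong (_+ f n) (∑-reverse n f))
  (trans (+-comm _ (f n)) (sym (∑-shift n (λ k → f (suc n ∸ suc k)))))

∑-head-zero : ∀ l N (f : ℕ → ℚ) → (∀ k → k ℕ.< l → f k ≡ 0ℚ) → ∑ (l ℕ.+ N) f ≡ ∑[ i < N ] f (l ℕ.+ i)
∑-head-zero zero N f z = refl
∑-head-zero (suc l) N f z = begin
  ∑ (suc l ℕ.+ N) f                       ≡⟨ ∑-shift (l ℕ.+ N) f ⟩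
  f 0 + ∑[ k < l ℕ.+ N ] f (suc k)         ≡⟨ cong₂ _+_ (z 0 (s≤s z≤n)) (∑-head-zero l N (λ k → f (suc k)) (λ k k<l → z (suc k) (s≤s k<l))) ⟩
  0ℚ + ∑[ i < N ] f (suc l ℕ.+ i)          ≡⟨ +-identityˡ _ ⟩
  ∑[ i < N ] f (suc l ℕ.+ i)               ∎

∑-tail-zero : ∀ {n N} (f : ℕ → ℚ) → n ℕ.≤ N → (∀ k → n ℕ.≤ k → f k ≡ 0ℚ) → ∑ N f ≡ ∑ n f
∑-tail-zero {N = zero} f z≤n z = refl
∑-tail-zero {n} {suc N} f n≤1+N z with ℕ.m≤n⇒m<n∨m≡n n≤1+N
... | inj₁ (s≤s n≤N) = trans (cong₂ _+_ (∑-tail-zero f n≤N z) (z N n≤N)) (+-identityʳ (∑ n f))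
... | inj₂ refl = refl

∑-telescope : ∀ n (f : ℕ → ℚ) → ∑[ j < n ] (f j - f (suc j)) ≡ f 0 - f n
∑-telescope zero f = solve 1 (λ a → con 0ℚ := a :- a) refl (f 0)
∑-telescope (suc n) f = trans (cong (_+ (f n - f (suc n))) (∑-telescope n f))
  (solve 3 (λ a b c → (a :- b) :+ (b :- c) := a :- c) refl (f 0) (f n) (f (suc n)))

∑-rotate : ∀ N (f : ℕ → ℚ) → f 0 ≡ f N → ∑[ k < N ] f (suc k) ≡ ∑ N f
∑-rotate N f f0≡fN = +-cancelˡ (f N) _ _ (begin
  f N + ∑[ k < N ] f (suc k)   ≡⟨ cong (_+ ∑[ k < N ] f (suc k)) (sym f0≡fN) ⟩
  f 0 + ∑[ k < N ] f (suc k)   ≡⟨ sym (∑-shift N f) ⟩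
  ∑ N f + f N                  ≡⟨ +-comm (∑ N f) (f N) ⟩
  f N + ∑ N f                  ∎)

δ₀ : ℕ → ℚ
δ₀ zero = 1ℚ
δ₀ (suc _) = 0ℚ

∑-δ₀ : ∀ N (f : ℕ → ℚ) → ∑[ l < suc N ] (f l * δ₀ (N ∸ l)) ≡ f N
∑-δ₀ N f = begin
  ∑[ l < N ] (f l * δ₀ (N ∸ l)) + f N * δ₀ (N ∸ N)  ≡⟨ cong₂ _+_ (∑-cong< N vanish) (cong (λ i → f N * δ₀ i) (ℕ.n∸n≡0 N)) ⟩
  ∑[ l < N ] 0ℚ + f N * 1ℚ                          ≡⟨ cong₂ _+_ (∑-zero N) (*-identityʳ (f N)) ⟩
  0ℚ + f N                                          ≡⟨ +-identityˡ (f N) ⟩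
  f N                                               ∎
  where
  vanish : ∀ l → l ℕ.< N → f l * δ₀ (N ∸ l) ≡ 0ℚ
  vanish l l<N rewrite ℕ.+-∸-assoc 1 l<N = *-zeroʳ (f l)


-- Coefficient sequences

-- If s lists the coefficients of a polynomial p, then mulX s lists those of x · p.
mulX : (ℕ → ℚ) → ℕ → ℚ
mulX s zero = 0ℚ
mulX s (suc k) = s k

mulX-cong : ∀ {s t : ℕ → ℚ} → (∀ k → s k ≡ t k) → ∀ j → mulX s j ≡ mulX t j
mulX-cong eq zero = refl
mulX-cong eq (suc j) = eq j

∑-mulX : ∀ N (s f : ℕ → ℚ) → ∑[ k < suc N ] (mulX s k * f k) ≡ ∑[ k < N ] (s k * f (suc k))
∑-mulX N s f =
  trans (∑-shift N (λ k → mulX s k * f k)) (trans (cong (_+ ∑[ k < N ] (s k * f (suc k))) (*-zeroˡ (f 0))) (+-identityˡ _))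

∑-mulX-comm : ∀ N (c : ℕ → ℚ) (s : ℕ → ℕ → ℚ) j → ∑[ i < N ] (c i * mulX (s i) j) ≡ mulX (λ k → ∑[ i < N ] (c i * s i k)) j
∑-mulX-comm N c s zero = trans (∑-cong N (λ i → *-zeroʳ (c i))) (∑-zero N)
∑-mulX-comm N c s (suc j) = refl

-- t lists the coefficients of (x + a₀) · p in the monomial basis (a k = a₀) or in the falling-factorial
-- basis (a k = k + a₀); the hypothesis on f is what multiplication by x + a₀ does to the values f of a
-- linear functional on that basis.
∑-linearFactor : ∀ N (s t a f g : ℕ → ℚ) c → s N ≡ 0ℚ →
  (∀ k → t k ≡ mulX s k + a k * s k) →
  (∀ k → f (suc k) + a k * f k ≡ c * f k + g k) →
  ∑[ k < suc N ] (t k * f k) ≡ c * ∑[ k < N ] (s k * f k) + ∑[ k < N ] (s k * g k)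
∑-linearFactor N s t a f g c sN≡0 t≡ f-step = begin
  ∑[ k < suc N ] (t k * f k)
    ≡⟨ ∑-cong (suc N) (λ k → trans (cong (_* f k) (t≡ k)) (*-distribʳ-+ (f k) (mulX s k) (a k * s k))) ⟩
  ∑[ k < suc N ] (mulX s k * f k + a k * s k * f k)
    ≡⟨ ∑-distrib-+ (suc N) (λ k → mulX s k * f k) (λ k → a k * s k * f k) ⟩
  ∑[ k < suc N ] (mulX s k * f k) + (∑[ k < N ] (a k * s k * f k) + a N * s N * f N)
    ≡⟨ cong₂ _+_ (∑-mulX N s f) (cong (_+_ (∑[ k < N ] (a k * s k * f k))) last≡0) ⟩
  ∑[ k < N ] (s k * f (suc k)) + (∑[ k < N ] (a k * s k * f k) + 0ℚ)
    ≡⟨ cong (_+_ (∑[ k < N ] (s k * f (suc k)))) (+-identityʳ _) ⟩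
  ∑[ k < N ] (s k * f (suc k)) + ∑[ k < N ] (a k * s k * f k)
    ≡⟨ sym (∑-distrib-+ N (λ k → s k * f (suc k)) (λ k → a k * s k * f k)) ⟩
  ∑[ k < N ] (s k * f (suc k) + a k * s k * f k)
    ≡⟨ ∑-cong N step ⟩
  ∑[ k < N ] (c * (s k * f k) + s k * g k)
    ≡⟨ ∑-distrib-+ N (λ k → c * (s k * f k)) (λ k → s k * g k) ⟩
  ∑[ k < N ] (c * (s k * f k)) + ∑[ k < N ] (s k * g k)
    ≡⟨ cong (_+ ∑[ k < N ] (s k * g k)) (∑-*ˡ N c (λ k → s k * f k)) ⟩
  c * ∑[ k < N ] (s k * f k) + ∑[ k < N ] (s k * g k) ∎
  where
  last≡0 : a N * s N * f N ≡ 0ℚ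
  last≡0 rewrite sN≡0 = trans (cong (_* f N) (*-zeroʳ (a N))) (*-zeroˡ (f N))
  step : ∀ k → s k * f (suc k) + a k * s k * f k ≡ c * (s k * f k) + s k * g k
  step k = begin
    s k * f (suc k) + a k * s k * f k
      ≡⟨ solve 4 (λ s f′ a f → s :* f′ :+ a :* s :* f := s :* (f′ :+ a :* f)) refl (s k) (f (suc k)) (a k) (f k) ⟩
    s k * (f (suc k) + a k * f k)  ≡⟨ cong (s k *_) (f-step k) ⟩
    s k * (c * f k + g k)
      ≡⟨ solve 4 (λ s c f g → s :* (c :* f :+ g) := c :* (s :* f) :+ s :* g) refl (s k) c (f k) (g k) ⟩
    c * (s k * f k) + s k * g k ∎

∑-linearFactor₀ : ∀ N (s t a f : ℕ → ℚ) c → s N ≡ 0ℚ →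
  (∀ k → t k ≡ mulX s k + a k * s k) →
  (∀ k → f (suc k) + a k * f k ≡ c * f k) →
  ∑[ k < suc N ] (t k * f k) ≡ c * ∑[ k < N ] (s k * f k)
∑-linearFactor₀ N s t a f c sN≡0 t≡ f-step = begin
  ∑[ k < suc N ] (t k * f k)
    ≡⟨ ∑-linearFactor N s t a f (λ _ → 0ℚ) c sN≡0 t≡ (λ k → trans (f-step k) (sym (+-identityʳ (c * f k)))) ⟩
  c * ∑[ k < N ] (s k * f k) + ∑[ k < N ] (s k * 0ℚ)
    ≡⟨ cong (_+_ (c * ∑[ k < N ] (s k * f k))) (trans (∑-cong N (λ k → *-zeroʳ (s k))) (∑-zero N)) ⟩
  c * ∑[ k < N ] (s k * f k) + 0ℚ
    ≡⟨ +-identityʳ _ ⟩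
  c * ∑[ k < N ] (s k * f k) ∎


-- Binomial coefficients

C-pascal : ∀ n j → ℕ→ℚ (suc n C j) ≡ mulX (λ i → ℕ→ℚ (n C i)) j + ℕ→ℚ (n C j)
C-pascal n zero = sym (+-identityˡ 1ℚ)
C-pascal n (suc j) = trans (cong ℕ→ℚ (sym (nCk+nC[k+1]≡[n+1]C[k+1] n j))) (ℕ→ℚ-homo-+ (n C j) (n C suc j))

[1+n]Cn≡1+n : ∀ n → suc n C n ≡ suc n
[1+n]Cn≡1+n n = trans (nCk≡nC[n∸k] (ℕ.n≤1+n n)) (trans (cong (suc n C_) (ℕ.m+n∸n≡m 1 n)) (nC1≡n (suc n)))

C-*-factorials : ∀ {n k} → k ℕ.≤ n → (n C k) ℕ.* (k ! ℕ.* (n ∸ k) !) ≡ n !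
C-*-factorials {n} {k} k≤n =
  trans (cong (ℕ._* (k ! ℕ.* (n ∸ k) !)) (nCk≡n!/k![n-k]! k≤n)) (m/n*n≡m {{k !* (n ∸ k) !≢0}} (k![n∸k]!∣n! k≤n))

-- When l + i ≤ N, both sides times l! i! (N - l - i)! equal N!; otherwise both vanish.
C-trinomial : ∀ N l i → (N C (l ℕ.+ i)) ℕ.* ((l ℕ.+ i) C l) ≡ (N C l) ℕ.* ((N ∸ l) C i)
C-trinomial N l i with l ℕ.+ i ℕ.≤? N
... | yes l+i≤N = ℕ.*-cancelʳ-≡ _ _ d {{ℕ.m*n≢0 (l !) _ {{l !≢0}} {{i !* (N ∸ (l ℕ.+ i)) !≢0}}}} (trans lhs (sym rhs))
  where
  d = l ! ℕ.* (i ! ℕ.* (N ∸ (l ℕ.+ i)) !)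
  l≤N : l ℕ.≤ N
  l≤N = ℕ.≤-trans (ℕ.m≤m+n l i) l+i≤N
  i≤N∸l : i ℕ.≤ N ∸ l
  i≤N∸l = subst (ℕ._≤ N ∸ l) (ℕ.m+n∸m≡n l i) (ℕ.∸-monoˡ-≤ l l+i≤N)
  lhs : (N C (l ℕ.+ i)) ℕ.* ((l ℕ.+ i) C l) ℕ.* d ≡ N !
  lhs = begin
    (N C (l ℕ.+ i)) ℕ.* ((l ℕ.+ i) C l) ℕ.* d
      ≡⟨ solveℕ 5 (λ a b c e f → a ⊗ b ⊗ (c ⊗ (e ⊗ f)) ⊜ a ⊗ ((b ⊗ (c ⊗ e)) ⊗ f)) refl
           (N C (l ℕ.+ i)) ((l ℕ.+ i) C l) (l !) (i !) ((N ∸ (l ℕ.+ i)) !) ⟩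
    (N C (l ℕ.+ i)) ℕ.* (((l ℕ.+ i) C l) ℕ.* (l ! ℕ.* i !) ℕ.* (N ∸ (l ℕ.+ i)) !)
      ≡⟨ cong (λ t → (N C (l ℕ.+ i)) ℕ.* (((l ℕ.+ i) C l) ℕ.* (l ! ℕ.* t !) ℕ.* (N ∸ (l ℕ.+ i)) !)) (sym (ℕ.m+n∸m≡n l i)) ⟩
    (N C (l ℕ.+ i)) ℕ.* (((l ℕ.+ i) C l) ℕ.* (l ! ℕ.* (l ℕ.+ i ∸ l) !) ℕ.* (N ∸ (l ℕ.+ i)) !)
      ≡⟨ cong (λ t → (N C (l ℕ.+ i)) ℕ.* (t ℕ.* (N ∸ (l ℕ.+ i)) !)) (C-*-factorials (ℕ.m≤m+n l i)) ⟩
    (N C (l ℕ.+ i)) ℕ.* ((l ℕ.+ i) ! ℕ.* (N ∸ (l ℕ.+ i)) !)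
      ≡⟨ C-*-factorials l+i≤N ⟩
    N ! ∎
  rhs : (N C l) ℕ.* ((N ∸ l) C i) ℕ.* d ≡ N !
  rhs = begin
    (N C l) ℕ.* ((N ∸ l) C i) ℕ.* d
      ≡⟨ cong (λ t → (N C l) ℕ.* ((N ∸ l) C i) ℕ.* (l ! ℕ.* (i ! ℕ.* t !))) (sym (ℕ.∸-+-assoc N l i)) ⟩
    (N C l) ℕ.* ((N ∸ l) C i) ℕ.* (l ! ℕ.* (i ! ℕ.* (N ∸ l ∸ i) !))
      ≡⟨ solveℕ 5 (λ a b c e f → a ⊗ b ⊗ (c ⊗ (e ⊗ f)) ⊜ a ⊗ (c ⊗ (b ⊗ (e ⊗ f)))) refl
           (N C l) ((N ∸ l) C i) (l !) (i !) ((N ∸ l ∸ i) !) ⟩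
    (N C l) ℕ.* (l ! ℕ.* (((N ∸ l) C i) ℕ.* (i ! ℕ.* (N ∸ l ∸ i) !)))
      ≡⟨ cong (λ t → (N C l) ℕ.* (l ! ℕ.* t)) (C-*-factorials i≤N∸l) ⟩
    (N C l) ℕ.* (l ! ℕ.* (N ∸ l) !)
      ≡⟨ C-*-factorials l≤N ⟩
    N ! ∎
... | no l+i≰N with l ℕ.≤? N
...   | yes l≤N = begin
  (N C (l ℕ.+ i)) ℕ.* ((l ℕ.+ i) C l)  ≡⟨ cong (ℕ._* ((l ℕ.+ i) C l)) (k>n⇒nCk≡0 (ℕ.≰⇒> l+i≰N)) ⟩
  0                                   ≡⟨ sym (ℕ.*-zeroʳ (N C l)) ⟩
  (N C l) ℕ.* 0                       ≡⟨ cong ((N C l) ℕ.*_) (sym (k>n⇒nCk≡0 N∸l<i)) ⟩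
  (N C l) ℕ.* ((N ∸ l) C i)           ∎
  where
  N∸l<i : N ∸ l ℕ.< i
  N∸l<i = ℕ.+-cancelˡ-< l (N ∸ l) i (subst (ℕ._< l ℕ.+ i) (sym (ℕ.m+[n∸m]≡n l≤N)) (ℕ.≰⇒> l+i≰N))
...   | no l≰N = trans (cong (ℕ._* ((l ℕ.+ i) C l)) (k>n⇒nCk≡0 (ℕ.≰⇒> l+i≰N)))
                       (sym (cong (ℕ._* ((N ∸ l) C i)) (k>n⇒nCk≡0 (ℕ.≰⇒> l≰N))))

∑-binomial-suc : ∀ n (v : ℕ → ℚ) →
  ∑[ j < suc (suc n) ] (ℕ→ℚ (suc n C j) * v j) ≡ ∑[ j < suc n ] (ℕ→ℚ (n C j) * v j) + ∑[ j < suc n ] (ℕ→ℚ (n C j) * v (suc j))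
∑-binomial-suc n v = trans
  (∑-linearFactor (suc n) (λ j → ℕ→ℚ (n C j)) (λ j → ℕ→ℚ (suc n C j)) (λ _ → 1ℚ) v (λ j → v (suc j)) 1ℚ
     (cong ℕ→ℚ (k>n⇒nCk≡0 (ℕ.n<1+n n)))
     (λ j → trans (C-pascal n j) (cong (_+_ (mulX (λ i → ℕ→ℚ (n C i)) j)) (sym (*-identityˡ (ℕ→ℚ (n C j))))))
     (λ j → +-comm (v (suc j)) (1ℚ * v j)))
  (cong (_+ ∑[ j < suc n ] (ℕ→ℚ (n C j) * v (suc j))) (*-identityˡ (∑[ j < suc n ] (ℕ→ℚ (n C j) * v j))))

-- If s lists the coefficients of a polynomial p of degree < N, then taylorShift N s lists those of p (x + 1).
taylorShift : ℕ → (ℕ → ℚ) → ℕ → ℚ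
taylorShift N s j = ∑[ k < N ] (s k * ℕ→ℚ (k C j))

taylorShift-linearFactor : ∀ N (s : ℕ → ℚ) a j → s N ≡ 0ℚ →
  taylorShift (suc N) (λ k → mulX s k + a * s k) j ≡ mulX (taylorShift N s) j + (1ℚ + a) * taylorShift N s j
taylorShift-linearFactor N s a j sN≡0 = begin
  taylorShift (suc N) (λ k → mulX s k + a * s k) j
    ≡⟨ ∑-linearFactor N s (λ k → mulX s k + a * s k) (λ _ → a) (λ k → ℕ→ℚ (k C j)) (λ k → mulX (λ i → ℕ→ℚ (k C i)) j)
         (1ℚ + a) sN≡0 (λ _ → refl) step ⟩
  (1ℚ + a) * taylorShift N s j + ∑[ k < N ] (s k * mulX (λ i → ℕ→ℚ (k C i)) j)
    ≡⟨ cong (_+_ ((1ℚ + a) * taylorShift N s j)) (∑-mulX-comm N s (λ k i → ℕ→ℚ (k C i)) j) ⟩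
  (1ℚ + a) * taylorShift N s j + mulX (taylorShift N s) j
    ≡⟨ +-comm ((1ℚ + a) * taylorShift N s j) (mulX (taylorShift N s) j) ⟩
  mulX (taylorShift N s) j + (1ℚ + a) * taylorShift N s j ∎
  where
  step : ∀ k → ℕ→ℚ (suc k C j) + a * ℕ→ℚ (k C j) ≡ (1ℚ + a) * ℕ→ℚ (k C j) + mulX (λ i → ℕ→ℚ (k C i)) j
  step k = trans (cong (_+ a * ℕ→ℚ (k C j)) (C-pascal k j))
    (solve 3 (λ p b a → p :+ b :+ a :* b := (con 1ℚ :+ a) :* b :+ p) refl (mulX (λ i → ℕ→ℚ (k C i)) j) (ℕ→ℚ (k C j)) a)

∑-taylorShift : ∀ N (s u : ℕ → ℚ) →
  ∑[ j < N ] (taylorShift N s j * u j) ≡ ∑[ k < N ] (s k * ∑[ j < suc k ] (ℕ→ℚ (k C j) * u j))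
∑-taylorShift N s u = begin
  ∑[ j < N ] (taylorShift N s j * u j)
    ≡⟨ ∑-cong N (λ j → sym (∑-*ʳ N (u j) (λ k → s k * ℕ→ℚ (k C j)))) ⟩
  ∑[ j < N ] ∑[ k < N ] (s k * ℕ→ℚ (k C j) * u j)
    ≡⟨ ∑-swap N N (λ j k → s k * ℕ→ℚ (k C j) * u j) ⟩
  ∑[ k < N ] ∑[ j < N ] (s k * ℕ→ℚ (k C j) * u j)
    ≡⟨ ∑-cong< N (λ k k<N → trans (∑-cong N (λ j → *-assoc (s k) (ℕ→ℚ (k C j)) (u j)))
                                  (trans (∑-*ˡ N (s k) (λ j → ℕ→ℚ (k C j) * u j)) (cong (s k *_) (truncate k k<N)))) ⟩
  ∑[ k < N ] (s k * ∑[ j < suc k ] (ℕ→ℚ (k C j) * u j)) ∎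
  where
  truncate : ∀ k → k ℕ.< N → ∑[ j < N ] (ℕ→ℚ (k C j) * u j) ≡ ∑[ j < suc k ] (ℕ→ℚ (k C j) * u j)
  truncate k k<N = ∑-tail-zero (λ j → ℕ→ℚ (k C j) * u j) k<N (λ j k<j → trans (cong (λ c → ℕ→ℚ c * u j) (k>n⇒nCk≡0 k<j)) (*-zeroˡ (u j)))


-- Derivatives of powers and factorial powers

-- The primed functions are the derivatives of y ^ k, z (z + 1) ⋯ (z + k - 1) and z (z - 1) ⋯ (z - k + 1)
-- with respect to y, resp. z, computed by the product rule.
pow′ : ℚ → ℕ → ℚ
pow′ y zero = 0ℚ
pow′ y (suc k) = y ^ℚ k + y * pow′ y k

rising′ : ℚ → ℕ → ℚ
rising′ z zero = 0ℚ
rising′ z (suc k) = rising′ z k * (z + ℕ→ℚ k) + rising z k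

falling : ℚ → ℕ → ℚ
falling z zero = 1ℚ
falling z (suc k) = falling z k * (z - ℕ→ℚ k)

falling′ : ℚ → ℕ → ℚ
falling′ z zero = 0ℚ
falling′ z (suc k) = falling′ z k * (z - ℕ→ℚ k) + falling z k

pow′-suc : ∀ y n → pow′ y (suc n) ≡ ℕ→ℚ (suc n) * y ^ℚ n
pow′-suc y zero = solve 1 (λ y → con 1ℚ :+ y :* con 0ℚ := con 1ℚ :* con 1ℚ) refl y
pow′-suc y (suc n) = begin
  y * y ^ℚ n + y * pow′ y (suc n)             ≡⟨ cong (λ t → y * y ^ℚ n + y * t) (pow′-suc y n) ⟩
  y * y ^ℚ n + y * (ℕ→ℚ (suc n) * y ^ℚ n)
    ≡⟨ solve 3 (λ y p c → y :* p :+ y :* (c :* p) := (con 1ℚ :+ c) :* (y :* p)) refl y (y ^ℚ n) (ℕ→ℚ (suc n)) ⟩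
  (1ℚ + ℕ→ℚ (suc n)) * (y * y ^ℚ n)          ≡⟨ cong (_* (y * y ^ℚ n)) (sym (ℕ→ℚ-suc (suc n))) ⟩
  ℕ→ℚ (suc (suc n)) * (y * y ^ℚ n)           ∎

falling-neg : ∀ z k → falling (- z) k ≡ sgn k * rising z k
falling-neg z zero = refl
falling-neg z (suc k) = begin
  falling (- z) k * (- z - ℕ→ℚ k)          ≡⟨ cong (_* (- z - ℕ→ℚ k)) (falling-neg z k) ⟩
  sgn k * rising z k * (- z - ℕ→ℚ k)
    ≡⟨ solve 4 (λ s r z a → s :* r :* (:- z :- a) := (:- con 1ℚ :* s) :* (r :* (z :+ a))) refl (sgn k) (rising z k) z (ℕ→ℚ k) ⟩
  - 1ℚ * sgn k * (rising z k * (z + ℕ→ℚ k)) ∎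

falling′-neg : ∀ z k → falling′ (- z) k ≡ - (sgn k * rising′ z k)
falling′-neg z zero = refl
falling′-neg z (suc k) = begin
  falling′ (- z) k * (- z - ℕ→ℚ k) + falling (- z) k
    ≡⟨ cong₂ (λ u v → u * (- z - ℕ→ℚ k) + v) (falling′-neg z k) (falling-neg z k) ⟩
  - (sgn k * rising′ z k) * (- z - ℕ→ℚ k) + sgn k * rising z k
    ≡⟨ solve 5 (λ s r′ r z a → :- (s :* r′) :* (:- z :- a) :+ s :* r := :- ((:- con 1ℚ :* s) :* (r′ :* (z :+ a) :+ r)))
         refl (sgn k) (rising′ z k) (rising z k) z (ℕ→ℚ k) ⟩
  - (- 1ℚ * sgn k * (rising′ z k * (z + ℕ→ℚ k) + rising z k)) ∎

rising-peel : ∀ z n → rising z (suc n) ≡ z * rising (z + 1ℚ) n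
rising-peel z zero = solve 1 (λ z → con 1ℚ :* (z :+ con 0ℚ) := z :* con 1ℚ) refl z
rising-peel z (suc n) = begin
  rising z (suc n) * (z + ℕ→ℚ (suc n))      ≡⟨ cong₂ (λ u v → u * (z + v)) (rising-peel z n) (ℕ→ℚ-suc n) ⟩
  z * rising (z + 1ℚ) n * (z + (1ℚ + ℕ→ℚ n))
    ≡⟨ solve 3 (λ z r a → z :* r :* (z :+ (con 1ℚ :+ a)) := z :* (r :* ((z :+ con 1ℚ) :+ a))) refl z (rising (z + 1ℚ) n) (ℕ→ℚ n) ⟩
  z * (rising (z + 1ℚ) n * ((z + 1ℚ) + ℕ→ℚ n)) ∎

rising′-peel : ∀ z n → rising′ z (suc n) ≡ rising (z + 1ℚ) n + z * rising′ (z + 1ℚ) n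
rising′-peel z zero = solve 1 (λ z → con 0ℚ :* (z :+ con 0ℚ) :+ con 1ℚ := con 1ℚ :+ z :* con 0ℚ) refl z
rising′-peel z (suc n) = begin
  rising′ z (suc n) * (z + ℕ→ℚ (suc n)) + rising z (suc n)
    ≡⟨ cong₂ (λ u v → u * (z + v) + rising z (suc n)) (rising′-peel z n) (ℕ→ℚ-suc n) ⟩
  (R + z * R′) * (z + (1ℚ + ℕ→ℚ n)) + rising z (suc n)
    ≡⟨ cong (_+_ ((R + z * R′) * (z + (1ℚ + ℕ→ℚ n)))) (rising-peel z n) ⟩
  (R + z * R′) * (z + (1ℚ + ℕ→ℚ n)) + z * R
    ≡⟨ solve 4 (λ z r r′ a → (r :+ z :* r′) :* (z :+ (con 1ℚ :+ a)) :+ z :* r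
                           := r :* ((z :+ con 1ℚ) :+ a) :+ z :* (r′ :* ((z :+ con 1ℚ) :+ a) :+ r)) refl z R R′ (ℕ→ℚ n) ⟩
  R * ((z + 1ℚ) + ℕ→ℚ n) + z * (R′ * ((z + 1ℚ) + ℕ→ℚ n) + R) ∎
  where
  R = rising (z + 1ℚ) n
  R′ = rising′ (z + 1ℚ) n


-- Hyperharmonic numbers

module _ (r : ℤ) where
  private
    z = ℤ→ℚ r
    c = invPowCoeff r
    h : ℕ → ℚ
    h n = hyperharmonic n r
    w : ℕ → ℚ
    w j = + 1 / suc j

  factorial-invPowCoeff : ∀ i → ℕ→ℚ (i !) * c i ≡ rising z i
  factorial-invPowCoeff i = begin
    ℕ→ℚ (i !) * (rising z i * e)  ≡⟨ solve 3 (λ f r e → f :* (r :* e) := r :* (f :* e)) refl (ℕ→ℚ (i !)) (rising z i) e ⟩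
    rising z i * (ℕ→ℚ (i !) * e)  ≡⟨ cong (rising z i *_) (ℕ→ℚ-*-inverse (i !) {{i !≢0}}) ⟩
    rising z i * 1ℚ               ≡⟨ *-identityʳ (rising z i) ⟩
    rising z i                    ∎
    where e = (+ 1 / i !) {{i !≢0}}

  invPowCoeff-suc : ∀ i → ℕ→ℚ (suc i) * c (suc i) ≡ (z + ℕ→ℚ i) * c i
  invPowCoeff-suc i = ℕ→ℚ-*-cancelˡ (i !) {{i !≢0}} (begin
    ℕ→ℚ (i !) * (ℕ→ℚ (suc i) * c (suc i))
      ≡⟨ solve 3 (λ f a b → f :* (a :* b) := (a :* f) :* b) refl (ℕ→ℚ (i !)) (ℕ→ℚ (suc i)) (c (suc i)) ⟩
    ℕ→ℚ (suc i) * ℕ→ℚ (i !) * c (suc i)  ≡⟨ cong (_* c (suc i)) (sym (ℕ→ℚ-homo-* (suc i) (i !))) ⟩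
    ℕ→ℚ (suc i !) * c (suc i)            ≡⟨ factorial-invPowCoeff (suc i) ⟩
    rising z i * (z + ℕ→ℚ i)              ≡⟨ cong (_* (z + ℕ→ℚ i)) (sym (factorial-invPowCoeff i)) ⟩
    ℕ→ℚ (i !) * c i * (z + ℕ→ℚ i)
      ≡⟨ solve 3 (λ f a b → f :* a :* b := f :* (b :* a)) refl (ℕ→ℚ (i !)) (c i) (z + ℕ→ℚ i) ⟩
    ℕ→ℚ (i !) * ((z + ℕ→ℚ i) * c i)      ∎)

  private
    weight-inverse : ∀ j → ℕ→ℚ (suc j) * w j ≡ 1ℚ
    weight-inverse j = ℕ→ℚ-*-inverse (suc j)

    -- With n = k + (j + 1), (n + 1) / (j + 1) = 1 + (k + 1) / (j + 1) splits the j-th summand of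
    -- (n + 1) h (n + 1) into a telescoping difference and the j-th summand of (z + n) h n.
    term : ∀ j k → ℕ→ℚ (suc k ℕ.+ suc j) * (w j * c (suc k))
                 ≡ (c (suc k) - c k) + (z + ℕ→ℚ (k ℕ.+ suc j)) * (w j * c k)
    term j k = begin
      ℕ→ℚ (suc k ℕ.+ suc j) * (w j * c (suc k))
        ≡⟨ cong (_* (w j * c (suc k))) (ℕ→ℚ-homo-+ (suc k) (suc j)) ⟩
      (ℕ→ℚ (suc k) + ℕ→ℚ (suc j)) * (w j * c (suc k))
        ≡⟨ solve 4 (λ a b e x → (a :+ b) :* (e :* x) := e :* (a :* x) :+ (b :* e) :* x) refl (ℕ→ℚ (suc k)) (ℕ→ℚ (suc j)) (w j) (c (suc k)) ⟩
      w j * (ℕ→ℚ (suc k) * c (suc k)) + (ℕ→ℚ (suc j) * w j) * c (suc k)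
        ≡⟨ cong₂ (λ u v → w j * u + v * c (suc k)) (invPowCoeff-suc k) (weight-inverse j) ⟩
      w j * ((z + ℕ→ℚ k) * c k) + 1ℚ * c (suc k)
        ≡⟨ solve 5 (λ e z a x y → e :* ((z :+ a) :* x) :+ con 1ℚ :* y := (y :- x) :+ ((z :+ a) :* (e :* x) :+ con 1ℚ :* x))
             refl (w j) z (ℕ→ℚ k) (c k) (c (suc k)) ⟩
      (c (suc k) - c k) + ((z + ℕ→ℚ k) * (w j * c k) + 1ℚ * c k)
        ≡⟨ cong (λ u → (c (suc k) - c k) + ((z + ℕ→ℚ k) * (w j * c k) + u * c k)) (sym (weight-inverse j)) ⟩
      (c (suc k) - c k) + ((z + ℕ→ℚ k) * (w j * c k) + (ℕ→ℚ (suc j) * w j) * c k)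
        ≡⟨ cong (_+_ (c (suc k) - c k)) (solve 5 (λ z a b e x → (z :+ a) :* (e :* x) :+ (b :* e) :* x := (z :+ (a :+ b)) :* (e :* x))
             refl z (ℕ→ℚ k) (ℕ→ℚ (suc j)) (w j) (c k)) ⟩
      (c (suc k) - c k) + (z + (ℕ→ℚ k + ℕ→ℚ (suc j))) * (w j * c k)
        ≡⟨ cong (λ u → (c (suc k) - c k) + (z + u) * (w j * c k)) (sym (ℕ→ℚ-homo-+ k (suc j))) ⟩
      (c (suc k) - c k) + (z + ℕ→ℚ (k ℕ.+ suc j)) * (w j * c k) ∎

  hyperharmonic-suc : ∀ n → ℕ→ℚ (suc n) * h (suc n) ≡ (z + ℕ→ℚ n) * h n + c n
  hyperharmonic-suc n = begin
    ℕ→ℚ (suc n) * ∑[ j < suc n ] (w j * c (n ∸ j))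
      ≡⟨ sym (∑-*ˡ (suc n) (ℕ→ℚ (suc n)) (λ j → w j * c (n ∸ j))) ⟩
    ∑[ j < n ] (ℕ→ℚ (suc n) * (w j * c (n ∸ j))) + ℕ→ℚ (suc n) * (w n * c (n ∸ n))
      ≡⟨ cong₂ _+_ (∑-cong< n inner) last ⟩
    ∑[ j < n ] ((c (n ∸ j) - c (n ∸ suc j)) + (z + ℕ→ℚ n) * (w j * c (n ∸ suc j))) + c 0
      ≡⟨ cong (_+ c 0) (∑-distrib-+ n (λ j → c (n ∸ j) - c (n ∸ suc j)) (λ j → (z + ℕ→ℚ n) * (w j * c (n ∸ suc j)))) ⟩
    (∑[ j < n ] (c (n ∸ j) - c (n ∸ suc j)) + ∑[ j < n ] ((z + ℕ→ℚ n) * (w j * c (n ∸ suc j)))) + c 0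
      ≡⟨ cong₂ (λ u v → (u + v) + c 0) (∑-telescope n (λ j → c (n ∸ j))) (∑-*ˡ n (z + ℕ→ℚ n) (λ j → w j * c (n ∸ suc j))) ⟩
    ((c n - c (n ∸ n)) + (z + ℕ→ℚ n) * h n) + c 0
      ≡⟨ cong (λ i → ((c n - c i) + (z + ℕ→ℚ n) * h n) + c 0) (ℕ.n∸n≡0 n) ⟩
    ((c n - c 0) + (z + ℕ→ℚ n) * h n) + c 0
      ≡⟨ solve 3 (λ a b x → ((a :- b) :+ x) :+ b := x :+ a) refl (c n) (c 0) ((z + ℕ→ℚ n) * h n) ⟩
    (z + ℕ→ℚ n) * h n + c n ∎
    where
    inner : ∀ j → j ℕ.< n → ℕ→ℚ (suc n) * (w j * c (n ∸ j))
                          ≡ (c (n ∸ j) - c (n ∸ suc j)) + (z + ℕ→ℚ n) * (w j * c (n ∸ suc j))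
    inner j j<n rewrite ℕ.+-∸-assoc 1 j<n =
      subst (λ m → ℕ→ℚ (suc m) * (w j * c (suc k)) ≡ (c (suc k) - c k) + (z + ℕ→ℚ m) * (w j * c k))
            (ℕ.m∸n+n≡m j<n) (term j k)
      where k = n ∸ suc j
    last : ℕ→ℚ (suc n) * (w n * c (n ∸ n)) ≡ c 0
    last rewrite ℕ.n∸n≡0 n = begin
      ℕ→ℚ (suc n) * (w n * c 0)  ≡⟨ sym (*-assoc (ℕ→ℚ (suc n)) (w n) (c 0)) ⟩
      ℕ→ℚ (suc n) * w n * c 0    ≡⟨ cong (_* c 0) (weight-inverse n) ⟩
      1ℚ * c 0                   ≡⟨ *-identityˡ (c 0) ⟩
      c 0                        ∎

  factorial-hyperharmonic : ∀ n → ℕ→ℚ (n !) * h n ≡ rising′ z n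
  factorial-hyperharmonic zero = *-zeroʳ 1ℚ
  factorial-hyperharmonic (suc n) = begin
    ℕ→ℚ (suc n ℕ.* n !) * h (suc n)
      ≡⟨ cong (_* h (suc n)) (ℕ→ℚ-homo-* (suc n) (n !)) ⟩
    ℕ→ℚ (suc n) * ℕ→ℚ (n !) * h (suc n)
      ≡⟨ solve 3 (λ a f x → a :* f :* x := f :* (a :* x)) refl (ℕ→ℚ (suc n)) (ℕ→ℚ (n !)) (h (suc n)) ⟩
    ℕ→ℚ (n !) * (ℕ→ℚ (suc n) * h (suc n))
      ≡⟨ cong (ℕ→ℚ (n !) *_) (hyperharmonic-suc n) ⟩
    ℕ→ℚ (n !) * ((z + ℕ→ℚ n) * h n + c n)
      ≡⟨ solve 4 (λ f a x y → f :* (a :* x :+ y) := (f :* x) :* a :+ f :* y) refl (ℕ→ℚ (n !)) (z + ℕ→ℚ n) (h n) (c n) ⟩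
    ℕ→ℚ (n !) * h n * (z + ℕ→ℚ n) + ℕ→ℚ (n !) * c n
      ≡⟨ cong₂ (λ u v → u * (z + ℕ→ℚ n) + v) (factorial-hyperharmonic n) (factorial-invPowCoeff n) ⟩
    rising′ z n * (z + ℕ→ℚ n) + rising z n ∎

falling′-neg-hyperharmonic : ∀ r k →
  ℕ→ℚ (suc k) * (sgn k * ℕ→ℚ (k !) * hyperharmonic (suc k) (+ r)) ≡ falling′ (- ℕ→ℚ r) (suc k)
falling′-neg-hyperharmonic r k = begin
  ℕ→ℚ (suc k) * (sgn k * ℕ→ℚ (k !) * h)
    ≡⟨ solve 4 (λ c s f h → c :* (s :* f :* h) := :- (:- con 1ℚ :* s) :* (c :* f :* h)) refl (ℕ→ℚ (suc k)) (sgn k) (ℕ→ℚ (k !)) h ⟩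
  - sgn (suc k) * (ℕ→ℚ (suc k) * ℕ→ℚ (k !) * h)
    ≡⟨ cong (λ t → - sgn (suc k) * (t * h)) (sym (ℕ→ℚ-homo-* (suc k) (k !))) ⟩
  - sgn (suc k) * (ℕ→ℚ (suc k !) * h)
    ≡⟨ cong (- sgn (suc k) *_) (factorial-hyperharmonic (+ r) (suc k)) ⟩
  - sgn (suc k) * rising′ (ℕ→ℚ r) (suc k)
    ≡⟨ sym (neg-distribˡ-* (sgn (suc k)) (rising′ (ℕ→ℚ r) (suc k))) ⟩
  - (sgn (suc k) * rising′ (ℕ→ℚ r) (suc k))
    ≡⟨ sym (falling′-neg (ℕ→ℚ r) (suc k)) ⟩
  falling′ (- ℕ→ℚ r) (suc k) ∎
  where h = hyperharmonic (suc k) (+ r)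


-- Bernoulli numbers and polynomials

lastOr0-∷ʳ : ∀ xs x → lastOr0 (xs ∷ʳ x) ≡ x
lastOr0-∷ʳ [] x = refl
lastOr0-∷ʳ (y ∷ []) x = refl
lastOr0-∷ʳ (y ∷ z ∷ zs) x = lastOr0-∷ʳ (z ∷ zs) x

length-bernList : ∀ n → length (bernList n) ≡ suc n
length-bernList zero = refl
length-bernList (suc n) = trans (List.length-++ (bernList n)) (trans (cong (ℕ._+ 1) (length-bernList n)) (ℕ.+-comm (suc n) 1))

zipWith-∷ʳ : ∀ {A B D : Set} (f : A → B → D) xs ys x y → length xs ≡ length ys →
  zipWith f (xs ∷ʳ x) (ys ∷ʳ y) ≡ zipWith f xs ys ∷ʳ f x y
zipWith-∷ʳ f [] [] x y _ = refl
zipWith-∷ʳ f (a ∷ xs) (b ∷ ys) x y eq = cong (f a b ∷_) (zipWith-∷ʳ f xs ys x y (ℕ.suc-injective eq))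

foldl-zipWith-bernList : ∀ n (g : ℕ → ℚ → ℚ) →
  foldl _+_ 0ℚ (zipWith g (upTo (suc n)) (bernList n)) ≡ ∑[ k < suc n ] g k (bernoulliNumber k)
foldl-zipWith-bernList zero g = refl
foldl-zipWith-bernList (suc n) g = begin
  foldl _+_ 0ℚ (zipWith g (upTo (suc (suc n))) (bernList n ∷ʳ b))
    ≡⟨ cong (λ ks → foldl _+_ 0ℚ (zipWith g ks (bernList n ∷ʳ b))) (sym (List.upTo-∷ʳ (suc n))) ⟩
  foldl _+_ 0ℚ (zipWith g (upTo (suc n) ∷ʳ suc n) (bernList n ∷ʳ b))
    ≡⟨ cong (foldl _+_ 0ℚ) (zipWith-∷ʳ g (upTo (suc n)) (bernList n) (suc n) b
         (trans (List.length-upTo (suc n)) (sym (length-bernList n)))) ⟩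
  foldl _+_ 0ℚ (zipWith g (upTo (suc n)) (bernList n) ∷ʳ g (suc n) b)
    ≡⟨ List.foldl-∷ʳ _+_ 0ℚ (g (suc n) b) (zipWith g (upTo (suc n)) (bernList n)) ⟩
  foldl _+_ 0ℚ (zipWith g (upTo (suc n)) (bernList n)) + g (suc n) b
    ≡⟨ cong₂ _+_ (foldl-zipWith-bernList n g) (cong (g (suc n)) (sym (lastOr0-∷ʳ (bernList n) b))) ⟩
  ∑[ k < suc n ] g k (bernoulliNumber k) + g (suc n) (bernoulliNumber (suc n)) ∎
  where b = bernNext n (bernList n)

∑-binomial-bernoulliNumber : ∀ M → ∑[ i < suc M ] (ℕ→ℚ (suc M C i) * bernoulliNumber i) ≡ δ₀ M
∑-binomial-bernoulliNumber zero = refl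
∑-binomial-bernoulliNumber (suc n) = begin
  S + ℕ→ℚ (suc (suc n) C suc n) * bernoulliNumber (suc n)
    ≡⟨ cong₂ (λ a b → S + ℕ→ℚ a * b) ([1+n]Cn≡1+n (suc n)) B-suc ⟩
  S + ℕ→ℚ (suc (suc n)) * (- (e * S))
    ≡⟨ solve 3 (λ s a e → s :+ a :* (:- (e :* s)) := s :- (a :* e) :* s) refl S (ℕ→ℚ (suc (suc n))) e ⟩
  S - (ℕ→ℚ (suc (suc n)) * e) * S
    ≡⟨ cong (λ t → S - t * S) (ℕ→ℚ-*-inverse (suc (suc n))) ⟩
  S - 1ℚ * S
    ≡⟨ solve 1 (λ s → s :- con 1ℚ :* s := con 0ℚ) refl S ⟩
  0ℚ ∎
  where
  S = ∑[ k < suc n ] (ℕ→ℚ (suc (suc n) C k) * bernoulliNumber k)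
  e = + 1 / suc (suc n)
  B-suc : bernoulliNumber (suc n) ≡ - (e * S)
  B-suc = trans (lastOr0-∷ʳ (bernList n) _)
    (cong (λ t → - (e * t)) (foldl-zipWith-bernList n (λ k b → ℕ→ℚ (suc (suc n) C k) * b)))

bernoulliPoly-ascending : ∀ y j → bernoulliPoly j y ≡ ∑[ l < suc j ] (ℕ→ℚ (j C l) * bernoulliNumber (j ∸ l) * y ^ℚ l)
bernoulliPoly-ascending y j = trans (sumTo≡∑ j f) (trans (∑-reverse (suc j) f) (∑-cong< (suc j) reflect))
  where
  f : ℕ → ℚ
  f i = ℕ→ℚ (j C i) * bernoulliNumber i * y ^ℚ (j ∸ i)
  reflect : ∀ l → l ℕ.< suc j → f (j ∸ l) ≡ ℕ→ℚ (j C l) * bernoulliNumber (j ∸ l) * y ^ℚ l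
  reflect l (s≤s l≤j) =
    cong₂ (λ a b → ℕ→ℚ a * bernoulliNumber (j ∸ l) * y ^ℚ b) (sym (nCk≡nC[n∸k] l≤j)) (ℕ.m∸[m∸n]≡n l≤j)

∑-trinomial-bernoulliNumber : ∀ N l → l ℕ.≤ N →
  ∑[ j < suc N ] (ℕ→ℚ ((suc N C j) ℕ.* (j C l)) * bernoulliNumber (j ∸ l)) ≡ ℕ→ℚ (suc N C l) * δ₀ (N ∸ l)
∑-trinomial-bernoulliNumber N l l≤N = begin
  ∑ (suc N) T                   ≡⟨ cong (λ n → ∑ n T) (sym size) ⟩
  ∑ (l ℕ.+ suc M) T             ≡⟨ ∑-head-zero l (suc M) T below ⟩
  ∑[ i < suc M ] T (l ℕ.+ i)    ≡⟨ ∑-cong (suc M) factor ⟩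
  ∑[ i < suc M ] (ℕ→ℚ (suc N C l) * (ℕ→ℚ (suc M C i) * bernoulliNumber i))
    ≡⟨ ∑-*ˡ (suc M) (ℕ→ℚ (suc N C l)) (λ i → ℕ→ℚ (suc M C i) * bernoulliNumber i) ⟩
  ℕ→ℚ (suc N C l) * ∑[ i < suc M ] (ℕ→ℚ (suc M C i) * bernoulliNumber i)
    ≡⟨ cong (ℕ→ℚ (suc N C l) *_) (∑-binomial-bernoulliNumber M) ⟩
  ℕ→ℚ (suc N C l) * δ₀ M        ∎
  where
  M = N ∸ l
  T : ℕ → ℚ
  T j = ℕ→ℚ ((suc N C j) ℕ.* (j C l)) * bernoulliNumber (j ∸ l)
  size : l ℕ.+ suc M ≡ suc N
  size = trans (ℕ.+-suc l M) (cong suc (ℕ.m+[n∸m]≡n l≤N))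
  below : ∀ j → j ℕ.< l → T j ≡ 0ℚ
  below j j<l rewrite k>n⇒nCk≡0 j<l | ℕ.*-zeroʳ (suc N C j) = *-zeroˡ (bernoulliNumber (j ∸ l))
  factor : ∀ i → T (l ℕ.+ i) ≡ ℕ→ℚ (suc N C l) * (ℕ→ℚ (suc M C i) * bernoulliNumber i)
  factor i = begin
    ℕ→ℚ ((suc N C (l ℕ.+ i)) ℕ.* ((l ℕ.+ i) C l)) * bernoulliNumber (l ℕ.+ i ∸ l)
      ≡⟨ cong₂ (λ a b → ℕ→ℚ a * bernoulliNumber b) (C-trinomial (suc N) l i) (ℕ.m+n∸m≡n l i) ⟩
    ℕ→ℚ ((suc N C l) ℕ.* ((suc N ∸ l) C i)) * bernoulliNumber i
      ≡⟨ cong (λ m → ℕ→ℚ ((suc N C l) ℕ.* (m C i)) * bernoulliNumber i) (ℕ.+-∸-assoc 1 l≤N) ⟩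
    ℕ→ℚ ((suc N C l) ℕ.* (suc M C i)) * bernoulliNumber i
      ≡⟨ cong (_* bernoulliNumber i) (ℕ→ℚ-homo-* (suc N C l) (suc M C i)) ⟩
    ℕ→ℚ (suc N C l) * ℕ→ℚ (suc M C i) * bernoulliNumber i
      ≡⟨ *-assoc (ℕ→ℚ (suc N C l)) (ℕ→ℚ (suc M C i)) (bernoulliNumber i) ⟩
    ℕ→ℚ (suc N C l) * (ℕ→ℚ (suc M C i) * bernoulliNumber i) ∎

∑-binomial-bernoulliPoly : ∀ y n → ∑[ j < n ] (ℕ→ℚ (n C j) * bernoulliPoly j y) ≡ pow′ y n
∑-binomial-bernoulliPoly y zero = refl
∑-binomial-bernoulliPoly y (suc N) = begin
  ∑[ j < suc N ] (ℕ→ℚ (suc N C j) * bernoulliPoly j y)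
    ≡⟨ ∑-cong< (suc N) (λ j j<1+N → cong (ℕ→ℚ (suc N C j) *_) (ascending j (ℕ.m<1+n⇒m≤n j<1+N))) ⟩
  ∑[ j < suc N ] (ℕ→ℚ (suc N C j) * ∑[ l < suc N ] T j l)
    ≡⟨ ∑-cong (suc N) (λ j → sym (∑-*ˡ (suc N) (ℕ→ℚ (suc N C j)) (T j))) ⟩
  ∑[ j < suc N ] ∑[ l < suc N ] (ℕ→ℚ (suc N C j) * T j l)
    ≡⟨ ∑-swap (suc N) (suc N) (λ j l → ℕ→ℚ (suc N C j) * T j l) ⟩
  ∑[ l < suc N ] ∑[ j < suc N ] (ℕ→ℚ (suc N C j) * T j l)
    ≡⟨ ∑-cong< (suc N) (λ l l<1+N → inner l (ℕ.m<1+n⇒m≤n l<1+N)) ⟩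
  ∑[ l < suc N ] (y ^ℚ l * ℕ→ℚ (suc N C l) * δ₀ (N ∸ l))
    ≡⟨ ∑-δ₀ N (λ l → y ^ℚ l * ℕ→ℚ (suc N C l)) ⟩
  y ^ℚ N * ℕ→ℚ (suc N C N)
    ≡⟨ cong (λ m → y ^ℚ N * ℕ→ℚ m) ([1+n]Cn≡1+n N) ⟩
  y ^ℚ N * ℕ→ℚ (suc N)
    ≡⟨ trans (*-comm (y ^ℚ N) (ℕ→ℚ (suc N))) (sym (pow′-suc y N)) ⟩
  pow′ y (suc N) ∎
  where
  T : ℕ → ℕ → ℚ
  T j l = ℕ→ℚ (j C l) * bernoulliNumber (j ∸ l) * y ^ℚ l
  ascending : ∀ j → j ℕ.≤ N → bernoulliPoly j y ≡ ∑[ l < suc N ] T j l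
  ascending j j≤N = trans (bernoulliPoly-ascending y j) (sym (∑-tail-zero (T j) (s≤s j≤N) above))
    where
    above : ∀ l → suc j ℕ.≤ l → T j l ≡ 0ℚ
    above l j<l rewrite k>n⇒nCk≡0 j<l = trans (cong (_* y ^ℚ l) (*-zeroˡ (bernoulliNumber (j ∸ l)))) (*-zeroˡ (y ^ℚ l))
  inner : ∀ l → l ℕ.≤ N → ∑[ j < suc N ] (ℕ→ℚ (suc N C j) * T j l) ≡ y ^ℚ l * ℕ→ℚ (suc N C l) * δ₀ (N ∸ l)
  inner l l≤N = begin
    ∑[ j < suc N ] (ℕ→ℚ (suc N C j) * T j l)
      ≡⟨ ∑-cong (suc N) regroup ⟩
    ∑[ j < suc N ] (y ^ℚ l * (ℕ→ℚ ((suc N C j) ℕ.* (j C l)) * bernoulliNumber (j ∸ l)))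
      ≡⟨ ∑-*ˡ (suc N) (y ^ℚ l) (λ j → ℕ→ℚ ((suc N C j) ℕ.* (j C l)) * bernoulliNumber (j ∸ l)) ⟩
    y ^ℚ l * ∑[ j < suc N ] (ℕ→ℚ ((suc N C j) ℕ.* (j C l)) * bernoulliNumber (j ∸ l))
      ≡⟨ cong (y ^ℚ l *_) (∑-trinomial-bernoulliNumber N l l≤N) ⟩
    y ^ℚ l * (ℕ→ℚ (suc N C l) * δ₀ (N ∸ l))
      ≡⟨ sym (*-assoc (y ^ℚ l) (ℕ→ℚ (suc N C l)) (δ₀ (N ∸ l))) ⟩
    y ^ℚ l * ℕ→ℚ (suc N C l) * δ₀ (N ∸ l) ∎
    where
    regroup : ∀ j → ℕ→ℚ (suc N C j) * T j l ≡ y ^ℚ l * (ℕ→ℚ ((suc N C j) ℕ.* (j C l)) * bernoulliNumber (j ∸ l))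
    regroup j = begin
      ℕ→ℚ (suc N C j) * T j l
        ≡⟨ solve 4 (λ a b β p → a :* (b :* β :* p) := p :* (a :* b :* β)) refl
             (ℕ→ℚ (suc N C j)) (ℕ→ℚ (j C l)) (bernoulliNumber (j ∸ l)) (y ^ℚ l) ⟩
      y ^ℚ l * (ℕ→ℚ (suc N C j) * ℕ→ℚ (j C l) * bernoulliNumber (j ∸ l))
        ≡⟨ cong (λ t → y ^ℚ l * (t * bernoulliNumber (j ∸ l))) (sym (ℕ→ℚ-homo-* (suc N C j) (j C l))) ⟩
      y ^ℚ l * (ℕ→ℚ ((suc N C j) ℕ.* (j C l)) * bernoulliNumber (j ∸ l)) ∎

bernoulliPoly-difference : ∀ y k → ∑[ j < suc k ] (ℕ→ℚ (k C j) * bernoulliPoly j y) ≡ bernoulliPoly k y + pow′ y k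
bernoulliPoly-difference y k = begin
  ∑[ j < k ] (ℕ→ℚ (k C j) * bernoulliPoly j y) + ℕ→ℚ (k C k) * bernoulliPoly k y
    ≡⟨ cong₂ _+_ (∑-binomial-bernoulliPoly y k) (cong (λ c → ℕ→ℚ c * bernoulliPoly k y) (nCn≡1 k)) ⟩
  pow′ y k + 1ℚ * bernoulliPoly k y
    ≡⟨ solve 2 (λ p b → p :+ con 1ℚ :* b := b :+ p) refl (pow′ y k) (bernoulliPoly k y) ⟩
  bernoulliPoly k y + pow′ y k ∎

binomial-triangular-unique : ∀ (f g : ℕ → ℚ) →
  (∀ n → ∑[ j < suc n ] (ℕ→ℚ (suc n C j) * f j) ≡ ∑[ j < suc n ] (ℕ→ℚ (suc n C j) * g j)) →
  ∀ n → f n ≡ g n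
binomial-triangular-unique f g eq n = agree (suc n) n ℕ.≤-refl
  where
  agree : ∀ n k → k ℕ.< n → f k ≡ g k
  agree (suc n) k k<1+n with ℕ.m<1+n⇒m<n∨m≡n k<1+n
  ... | inj₁ k<n = agree n k k<n
  ... | inj₂ refl = ℕ→ℚ-*-cancelˡ (suc k) (begin
    ℕ→ℚ (suc k) * f k          ≡⟨ cong (λ m → ℕ→ℚ m * f k) (sym ([1+n]Cn≡1+n k)) ⟩
    ℕ→ℚ (suc k C k) * f k      ≡⟨ +-cancelˡ (∑[ j < k ] (ℕ→ℚ (suc k C j) * f j)) _ _ (trans (eq k) (cong (_+ _) (sym earlier))) ⟩
    ℕ→ℚ (suc k C k) * g k      ≡⟨ cong (λ m → ℕ→ℚ m * g k) ([1+n]Cn≡1+n k) ⟩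
    ℕ→ℚ (suc k) * g k          ∎)
    where
    earlier : ∑[ j < k ] (ℕ→ℚ (suc k C j) * f j) ≡ ∑[ j < k ] (ℕ→ℚ (suc k C j) * g j)
    earlier = ∑-cong< k (λ j j<k → cong (ℕ→ℚ (suc k C j) *_) (agree k j j<k))

bernoulliPoly-unique : ∀ y (f : ℕ → ℚ) → (∀ n → ∑[ j < suc n ] (ℕ→ℚ (suc n C j) * f j) ≡ pow′ y (suc n)) →
  ∀ n → f n ≡ bernoulliPoly n y
bernoulliPoly-unique y f eq = binomial-triangular-unique f (λ j → bernoulliPoly j y)
  (λ n → trans (eq n) (sym (∑-binomial-bernoulliPoly y (suc n))))


-- r-Stirling numbers

S₁ S₂ : ℕ → ℕ → ℕ → ℚ
S₁ m n k = ℕ→ℚ (rStirling1 m n k)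
S₂ m n k = ℕ→ℚ (rStirling2 m n k)

rStirling1-above : ∀ m {n k} → n ℕ.< k → rStirling1 m n k ≡ 0
rStirling1-above m {zero} {suc k} _ = refl
rStirling1-above m {suc n} {suc k} (s≤s n<k)
  rewrite rStirling1-above m n<k | rStirling1-above m (ℕ.m<n⇒m<1+n n<k) = ℕ.*-zeroʳ (n ℕ.+ m)

rStirling2-above : ∀ m {n k} → n ℕ.< k → rStirling2 m n k ≡ 0
rStirling2-above m {zero} {suc k} _ = refl
rStirling2-above m {suc n} {suc k} (s≤s n<k)
  rewrite rStirling2-above m n<k | rStirling2-above m (ℕ.m<n⇒m<1+n n<k) = ℕ.*-zeroʳ (suc k ℕ.+ m)

S₁-above : ∀ m n → S₁ m n (suc n) ≡ 0ℚ
S₁-above m n = cong ℕ→ℚ (rStirling1-above m {n} ℕ.≤-refl)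

S₂-above : ∀ m n → S₂ m n (suc n) ≡ 0ℚ
S₂-above m n = cong ℕ→ℚ (rStirling2-above m {n} ℕ.≤-refl)

S₁-suc : ∀ m n k → S₁ m (suc n) k ≡ mulX (S₁ m n) k + ℕ→ℚ (n ℕ.+ m) * S₁ m n k
S₁-suc m n zero = trans (ℕ→ℚ-homo-* (n ℕ.+ m) (rStirling1 m n 0)) (sym (+-identityˡ _))
S₁-suc m n (suc k) = trans (ℕ→ℚ-homo-+ (rStirling1 m n k) ((n ℕ.+ m) ℕ.* rStirling1 m n (suc k)))
  (cong (_+_ (S₁ m n k)) (ℕ→ℚ-homo-* (n ℕ.+ m) (rStirling1 m n (suc k))))

S₂-suc : ∀ m n k → S₂ m (suc n) k ≡ mulX (S₂ m n) k + ℕ→ℚ (k ℕ.+ m) * S₂ m n k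
S₂-suc m n zero = trans (ℕ→ℚ-homo-* m (rStirling2 m n 0)) (sym (+-identityˡ _))
S₂-suc m n (suc k) = trans (ℕ→ℚ-homo-+ (rStirling2 m n k) ((suc k ℕ.+ m) ℕ.* rStirling2 m n (suc k)))
  (cong (_+_ (S₂ m n k)) (ℕ→ℚ-homo-* (suc k ℕ.+ m) (rStirling2 m n (suc k))))

rStirling1-peel₀ : ∀ m n → rStirling1 m (suc n) 0 ≡ m ℕ.* rStirling1 (suc m) n 0
rStirling1-peel₀ m zero = refl
rStirling1-peel₀ m (suc n) = begin
  (suc n ℕ.+ m) ℕ.* rStirling1 m (suc n) 0          ≡⟨ cong ((suc n ℕ.+ m) ℕ.*_) (rStirling1-peel₀ m n) ⟩
  (suc n ℕ.+ m) ℕ.* (m ℕ.* rStirling1 (suc m) n 0)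
    ≡⟨ solveℕ 3 (λ n m a → (κ 1 ⊕ n ⊕ m) ⊗ (m ⊗ a) ⊜ m ⊗ ((n ⊕ (κ 1 ⊕ m)) ⊗ a)) refl n m (rStirling1 (suc m) n 0) ⟩
  m ℕ.* ((n ℕ.+ suc m) ℕ.* rStirling1 (suc m) n 0)   ∎

rStirling1-peel : ∀ m n k → rStirling1 m (suc n) (suc k) ≡ rStirling1 (suc m) n k ℕ.+ m ℕ.* rStirling1 (suc m) n (suc k)
rStirling1-peel m zero zero = refl
rStirling1-peel m zero (suc k) = refl
rStirling1-peel m (suc n) zero = begin
  rStirling1 m (suc n) 0 ℕ.+ (suc n ℕ.+ m) ℕ.* rStirling1 m (suc n) 1
    ≡⟨ cong₂ (λ a b → a ℕ.+ (suc n ℕ.+ m) ℕ.* b) (rStirling1-peel₀ m n) (rStirling1-peel m n 0) ⟩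
  m ℕ.* a ℕ.+ (suc n ℕ.+ m) ℕ.* (a ℕ.+ m ℕ.* b)
    ≡⟨ solveℕ 4 (λ n m a b → m ⊗ a ⊕ (κ 1 ⊕ n ⊕ m) ⊗ (a ⊕ m ⊗ b) ⊜ (n ⊕ (κ 1 ⊕ m)) ⊗ a ⊕ m ⊗ (a ⊕ (n ⊕ (κ 1 ⊕ m)) ⊗ b))
         refl n m a b ⟩
  (n ℕ.+ suc m) ℕ.* a ℕ.+ m ℕ.* (a ℕ.+ (n ℕ.+ suc m) ℕ.* b) ∎
  where
  a = rStirling1 (suc m) n 0
  b = rStirling1 (suc m) n 1
rStirling1-peel m (suc n) (suc k) = begin
  rStirling1 m (suc n) (suc k) ℕ.+ (suc n ℕ.+ m) ℕ.* rStirling1 m (suc n) (suc (suc k))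
    ≡⟨ cong₂ (λ u v → u ℕ.+ (suc n ℕ.+ m) ℕ.* v) (rStirling1-peel m n k) (rStirling1-peel m n (suc k)) ⟩
  (a ℕ.+ m ℕ.* b) ℕ.+ (suc n ℕ.+ m) ℕ.* (b ℕ.+ m ℕ.* c)
    ≡⟨ solveℕ 5 (λ n m a b c → (a ⊕ m ⊗ b) ⊕ (κ 1 ⊕ n ⊕ m) ⊗ (b ⊕ m ⊗ c)
                             ⊜ (a ⊕ (n ⊕ (κ 1 ⊕ m)) ⊗ b) ⊕ m ⊗ (b ⊕ (n ⊕ (κ 1 ⊕ m)) ⊗ c)) refl n m a b c ⟩
  (a ℕ.+ (n ℕ.+ suc m) ℕ.* b) ℕ.+ m ℕ.* (b ℕ.+ (n ℕ.+ suc m) ℕ.* c) ∎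
  where
  a = rStirling1 (suc m) n k
  b = rStirling1 (suc m) n (suc k)
  c = rStirling1 (suc m) n (suc (suc k))

S₁-peel : ∀ m n k → S₁ m (suc n) k ≡ mulX (S₁ (suc m) n) k + ℕ→ℚ m * S₁ (suc m) n k
S₁-peel m n zero = trans (cong ℕ→ℚ (rStirling1-peel₀ m n)) (trans (ℕ→ℚ-homo-* m (rStirling1 (suc m) n 0)) (sym (+-identityˡ _)))
S₁-peel m n (suc k) = trans (cong ℕ→ℚ (rStirling1-peel m n k))
  (trans (ℕ→ℚ-homo-+ (rStirling1 (suc m) n k) (m ℕ.* rStirling1 (suc m) n (suc k)))
         (cong (_+_ (S₁ (suc m) n k)) (ℕ→ℚ-homo-* m (rStirling1 (suc m) n (suc k)))))

rStirling2-param-suc : ∀ m n k → rStirling2 (suc m) n k ≡ rStirling2 m n k ℕ.+ suc k ℕ.* rStirling2 m n (suc k)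
rStirling2-param-suc m zero zero = refl
rStirling2-param-suc m zero (suc k) = sym (ℕ.*-zeroʳ (suc (suc k)))
rStirling2-param-suc m (suc n) zero = begin
  suc m ℕ.* rStirling2 (suc m) n 0             ≡⟨ cong (suc m ℕ.*_) (rStirling2-param-suc m n 0) ⟩
  suc m ℕ.* (a ℕ.+ 1 ℕ.* b)
    ≡⟨ solveℕ 3 (λ m a b → (κ 1 ⊕ m) ⊗ (a ⊕ κ 1 ⊗ b) ⊜ m ⊗ a ⊕ κ 1 ⊗ (a ⊕ (κ 1 ⊕ m) ⊗ b)) refl m a b ⟩
  m ℕ.* a ℕ.+ 1 ℕ.* (a ℕ.+ suc m ℕ.* b)         ∎
  where
  a = rStirling2 m n 0
  b = rStirling2 m n 1
rStirling2-param-suc m (suc n) (suc k) = begin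
  rStirling2 (suc m) n k ℕ.+ (suc k ℕ.+ suc m) ℕ.* rStirling2 (suc m) n (suc k)
    ≡⟨ cong₂ (λ u v → u ℕ.+ (suc k ℕ.+ suc m) ℕ.* v) (rStirling2-param-suc m n k) (rStirling2-param-suc m n (suc k)) ⟩
  (a ℕ.+ suc k ℕ.* b) ℕ.+ (suc k ℕ.+ suc m) ℕ.* (b ℕ.+ suc (suc k) ℕ.* c)
    ≡⟨ solveℕ 5 (λ k m a b c → (a ⊕ (κ 1 ⊕ k) ⊗ b) ⊕ ((κ 1 ⊕ k) ⊕ (κ 1 ⊕ m)) ⊗ (b ⊕ (κ 2 ⊕ k) ⊗ c)
                             ⊜ (a ⊕ ((κ 1 ⊕ k) ⊕ m) ⊗ b) ⊕ (κ 2 ⊕ k) ⊗ (b ⊕ ((κ 2 ⊕ k) ⊕ m) ⊗ c)) refl k m a b c ⟩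
  (a ℕ.+ (suc k ℕ.+ m) ℕ.* b) ℕ.+ suc (suc k) ℕ.* (b ℕ.+ (suc (suc k) ℕ.+ m) ℕ.* c) ∎
  where
  a = rStirling2 m n k
  b = rStirling2 m n (suc k)
  c = rStirling2 m n (suc (suc k))

S₂-param-suc : ∀ m n k → S₂ (suc m) n k ≡ S₂ m n k + ℕ→ℚ (suc k) * S₂ m n (suc k)
S₂-param-suc m n k = trans (cong ℕ→ℚ (rStirling2-param-suc m n k))
  (trans (ℕ→ℚ-homo-+ (rStirling2 m n k) (suc k ℕ.* rStirling2 m n (suc k)))
         (cong (_+_ (S₂ m n k)) (ℕ→ℚ-homo-* (suc k) (rStirling2 m n (suc k)))))

∑-S₁-pow : ∀ y m n → ∑[ k < suc n ] (S₁ m n k * y ^ℚ k) ≡ rising (y + ℕ→ℚ m) n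
∑-S₁-pow y m zero = refl
∑-S₁-pow y m (suc n) = begin
  ∑[ k < suc (suc n) ] (S₁ m (suc n) k * y ^ℚ k)
    ≡⟨ ∑-linearFactor₀ (suc n) (S₁ m n) (S₁ m (suc n)) (λ _ → a) (y ^ℚ_) (y + a) (S₁-above m n) (S₁-suc m n)
         (λ k → solve 3 (λ y a p → y :* p :+ a :* p := (y :+ a) :* p) refl y a (y ^ℚ k)) ⟩
  (y + a) * ∑[ k < suc n ] (S₁ m n k * y ^ℚ k)
    ≡⟨ cong₂ (λ u v → (y + u) * v) (ℕ→ℚ-homo-+ n m) (∑-S₁-pow y m n) ⟩
  (y + (ℕ→ℚ n + ℕ→ℚ m)) * rising (y + ℕ→ℚ m) n
    ≡⟨ solve 4 (λ y a b r → (y :+ (a :+ b)) :* r := r :* ((y :+ b) :+ a)) refl y (ℕ→ℚ n) (ℕ→ℚ m) (rising (y + ℕ→ℚ m) n) ⟩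
  rising (y + ℕ→ℚ m) (suc n) ∎
  where a = ℕ→ℚ (n ℕ.+ m)

∑-S₁-pow′ : ∀ y m n → ∑[ k < suc n ] (S₁ m n k * pow′ y k) ≡ rising′ (y + ℕ→ℚ m) n
∑-S₁-pow′ y m zero = refl
∑-S₁-pow′ y m (suc n) = begin
  ∑[ k < suc (suc n) ] (S₁ m (suc n) k * pow′ y k)
    ≡⟨ ∑-linearFactor (suc n) (S₁ m n) (S₁ m (suc n)) (λ _ → a) (pow′ y) (y ^ℚ_) (y + a) (S₁-above m n) (S₁-suc m n)
         (λ k → solve 4 (λ y a p p′ → p :+ y :* p′ :+ a :* p′ := (y :+ a) :* p′ :+ p) refl y a (y ^ℚ k) (pow′ y k)) ⟩
  (y + a) * ∑[ k < suc n ] (S₁ m n k * pow′ y k) + ∑[ k < suc n ] (S₁ m n k * y ^ℚ k)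
    ≡⟨ cong₂ _+_ (cong₂ (λ u v → (y + u) * v) (ℕ→ℚ-homo-+ n m) (∑-S₁-pow′ y m n)) (∑-S₁-pow y m n) ⟩
  (y + (ℕ→ℚ n + ℕ→ℚ m)) * rising′ (y + ℕ→ℚ m) n + rising (y + ℕ→ℚ m) n
    ≡⟨ solve 5 (λ y a b r′ r → (y :+ (a :+ b)) :* r′ :+ r := r′ :* ((y :+ b) :+ a) :+ r) refl
         y (ℕ→ℚ n) (ℕ→ℚ m) (rising′ (y + ℕ→ℚ m) n) (rising (y + ℕ→ℚ m) n) ⟩
  rising′ (y + ℕ→ℚ m) (suc n) ∎
  where a = ℕ→ℚ (n ℕ.+ m)

∑-S₂-falling : ∀ y m n → ∑[ k < suc n ] (S₂ m n k * falling y k) ≡ (y + ℕ→ℚ m) ^ℚ n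
∑-S₂-falling y m zero = refl
∑-S₂-falling y m (suc n) = trans
  (∑-linearFactor₀ (suc n) (S₂ m n) (S₂ m (suc n)) (λ k → ℕ→ℚ (k ℕ.+ m)) (falling y) (y + ℕ→ℚ m)
     (S₂-above m n) (S₂-suc m n) step)
  (cong ((y + ℕ→ℚ m) *_) (∑-S₂-falling y m n))
  where
  step : ∀ k → falling y (suc k) + ℕ→ℚ (k ℕ.+ m) * falling y k ≡ (y + ℕ→ℚ m) * falling y k
  step k = begin
    falling y k * (y - ℕ→ℚ k) + ℕ→ℚ (k ℕ.+ m) * falling y k
      ≡⟨ cong (λ t → falling y k * (y - ℕ→ℚ k) + t * falling y k) (ℕ→ℚ-homo-+ k m) ⟩
    falling y k * (y - ℕ→ℚ k) + (ℕ→ℚ k + ℕ→ℚ m) * falling y k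
      ≡⟨ solve 4 (λ f y a b → f :* (y :- a) :+ (a :+ b) :* f := (y :+ b) :* f) refl (falling y k) y (ℕ→ℚ k) (ℕ→ℚ m) ⟩
    (y + ℕ→ℚ m) * falling y k ∎

∑-S₂-falling′ : ∀ y m n → ∑[ k < suc n ] (S₂ m n k * falling′ y k) ≡ pow′ (y + ℕ→ℚ m) n
∑-S₂-falling′ y m zero = refl
∑-S₂-falling′ y m (suc n) = begin
  ∑[ k < suc (suc n) ] (S₂ m (suc n) k * falling′ y k)
    ≡⟨ ∑-linearFactor (suc n) (S₂ m n) (S₂ m (suc n)) (λ k → ℕ→ℚ (k ℕ.+ m)) (falling′ y) (falling y) (y + ℕ→ℚ m)
         (S₂-above m n) (S₂-suc m n) step ⟩
  (y + ℕ→ℚ m) * ∑[ k < suc n ] (S₂ m n k * falling′ y k) + ∑[ k < suc n ] (S₂ m n k * falling y k)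
    ≡⟨ cong₂ (λ u v → (y + ℕ→ℚ m) * u + v) (∑-S₂-falling′ y m n) (∑-S₂-falling y m n) ⟩
  (y + ℕ→ℚ m) * pow′ (y + ℕ→ℚ m) n + (y + ℕ→ℚ m) ^ℚ n
    ≡⟨ +-comm ((y + ℕ→ℚ m) * pow′ (y + ℕ→ℚ m) n) ((y + ℕ→ℚ m) ^ℚ n) ⟩
  pow′ (y + ℕ→ℚ m) (suc n) ∎
  where
  step : ∀ k → falling′ y (suc k) + ℕ→ℚ (k ℕ.+ m) * falling′ y k ≡ (y + ℕ→ℚ m) * falling′ y k + falling y k
  step k = begin
    falling′ y k * (y - ℕ→ℚ k) + falling y k + ℕ→ℚ (k ℕ.+ m) * falling′ y k
      ≡⟨ cong (λ t → falling′ y k * (y - ℕ→ℚ k) + falling y k + t * falling′ y k) (ℕ→ℚ-homo-+ k m) ⟩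
    falling′ y k * (y - ℕ→ℚ k) + falling y k + (ℕ→ℚ k + ℕ→ℚ m) * falling′ y k
      ≡⟨ solve 5 (λ f′ f y a b → f′ :* (y :- a) :+ f :+ (a :+ b) :* f′ := (y :+ b) :* f′ :+ f) refl
           (falling′ y k) (falling y k) y (ℕ→ℚ k) (ℕ→ℚ m) ⟩
    (y + ℕ→ℚ m) * falling′ y k + falling y k ∎

S₁-taylorShift : ∀ m n j → taylorShift (suc n) (S₁ m n) j ≡ S₁ (suc m) n j
S₁-taylorShift m zero zero = refl
S₁-taylorShift m zero (suc j) = refl
S₁-taylorShift m (suc n) j = begin
  taylorShift (suc (suc n)) (S₁ m (suc n)) j
    ≡⟨ ∑-cong (suc (suc n)) (λ k → cong (_* ℕ→ℚ (k C j)) (S₁-suc m n k)) ⟩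
  taylorShift (suc (suc n)) (λ k → mulX (S₁ m n) k + a * S₁ m n k) j
    ≡⟨ taylorShift-linearFactor (suc n) (S₁ m n) a j (S₁-above m n) ⟩
  mulX (taylorShift (suc n) (S₁ m n)) j + (1ℚ + a) * taylorShift (suc n) (S₁ m n) j
    ≡⟨ cong₂ (λ u v → u + (1ℚ + a) * v) (mulX-cong (S₁-taylorShift m n) j) (S₁-taylorShift m n j) ⟩
  mulX (S₁ (suc m) n) j + (1ℚ + a) * S₁ (suc m) n j
    ≡⟨ cong (λ c → mulX (S₁ (suc m) n) j + c * S₁ (suc m) n j) (trans (sym (ℕ→ℚ-suc (n ℕ.+ m))) (cong ℕ→ℚ (sym (ℕ.+-suc n m)))) ⟩
  mulX (S₁ (suc m) n) j + ℕ→ℚ (n ℕ.+ suc m) * S₁ (suc m) n j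
    ≡⟨ sym (S₁-suc (suc m) n j) ⟩
  S₁ (suc m) (suc n) j ∎
  where a = ℕ→ℚ (n ℕ.+ m)

S₂-binomial : ∀ m n k → S₂ (suc m) n k ≡ ∑[ j < suc n ] (ℕ→ℚ (n C j) * S₂ m j k)
S₂-binomial m zero zero = refl
S₂-binomial m zero (suc k) = refl
S₂-binomial m (suc n) k = sym (begin
  ∑[ j < suc (suc n) ] (ℕ→ℚ (suc n C j) * S₂ m j k)
    ≡⟨ ∑-binomial-suc n (λ j → S₂ m j k) ⟩
  ∑[ j < suc n ] (ℕ→ℚ (n C j) * S₂ m j k) + ∑[ j < suc n ] (ℕ→ℚ (n C j) * S₂ m (suc j) k)
    ≡⟨ cong₂ _+_ (sym (S₂-binomial m n k)) (∑-cong (suc n) (λ j → trans (cong (ℕ→ℚ (n C j) *_) (S₂-suc m j k)) (expand j))) ⟩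
  S₂ (suc m) n k + ∑[ j < suc n ] (ℕ→ℚ (n C j) * mulX (S₂ m j) k + a * (ℕ→ℚ (n C j) * S₂ m j k))
    ≡⟨ cong (_+_ (S₂ (suc m) n k)) (trans (∑-distrib-+ (suc n) _ _) (cong₂ _+_ (∑-mulX-comm (suc n) (λ j → ℕ→ℚ (n C j)) (S₂ m) k) (∑-*ˡ (suc n) a _))) ⟩
  S₂ (suc m) n k + (mulX (λ i → ∑[ j < suc n ] (ℕ→ℚ (n C j) * S₂ m j i)) k + a * ∑[ j < suc n ] (ℕ→ℚ (n C j) * S₂ m j k))
    ≡⟨ cong (_+_ (S₂ (suc m) n k)) (cong₂ (λ u v → u + a * v) (mulX-cong (λ i → sym (S₂-binomial m n i)) k) (sym (S₂-binomial m n k))) ⟩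
  S₂ (suc m) n k + (mulX (S₂ (suc m) n) k + a * S₂ (suc m) n k)
    ≡⟨ solve 3 (λ s p a → s :+ (p :+ a :* s) := p :+ (con 1ℚ :+ a) :* s) refl (S₂ (suc m) n k) (mulX (S₂ (suc m) n) k) a ⟩
  mulX (S₂ (suc m) n) k + (1ℚ + a) * S₂ (suc m) n k
    ≡⟨ cong (λ c → mulX (S₂ (suc m) n) k + c * S₂ (suc m) n k) (trans (sym (ℕ→ℚ-suc (k ℕ.+ m))) (cong ℕ→ℚ (sym (ℕ.+-suc k m)))) ⟩
  mulX (S₂ (suc m) n) k + ℕ→ℚ (k ℕ.+ suc m) * S₂ (suc m) n k
    ≡⟨ sym (S₂-suc (suc m) n k) ⟩
  S₂ (suc m) (suc n) k ∎)
  where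
  a = ℕ→ℚ (k ℕ.+ m)
  expand : ∀ j → ℕ→ℚ (n C j) * (mulX (S₂ m j) k + a * S₂ m j k) ≡ ℕ→ℚ (n C j) * mulX (S₂ m j) k + a * (ℕ→ℚ (n C j) * S₂ m j k)
  expand j = solve 4 (λ c p a s → c :* (p :+ a :* s) := c :* p :+ a :* (c :* s)) refl (ℕ→ℚ (n C j)) (mulX (S₂ m j) k) a (S₂ m j k)


-- The two identities

∑-S₁-bernoulliPoly : ∀ y m n →
  ℕ→ℚ (suc n) * ∑[ k < suc n ] (S₁ m n k * bernoulliPoly k y) ≡ rising′ (y + ℕ→ℚ m - 1ℚ) (suc n)
∑-S₁-bernoulliPoly y m n = +-cancelˡ Q _ _ (trans (sym viaSplit) viaShift)
  where
  s = S₁ m n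
  u : ℕ → ℚ
  u k = bernoulliPoly k y
  b = ℕ→ℚ m - 1ℚ
  -- the coefficients of (x + m - 1) · (x + m)^(n rising)
  q : ℕ → ℚ
  q k = mulX s k + b * s k
  Q = ∑[ k < suc (suc n) ] (q k * u k)

  split : ∀ k → S₁ m (suc n) k * u k ≡ q k * u k + ℕ→ℚ (suc n) * (s k * u k)
  split k = begin
    S₁ m (suc n) k * u k                                   ≡⟨ cong (_* u k) (S₁-suc m n k) ⟩
    (mulX s k + ℕ→ℚ (n ℕ.+ m) * s k) * u k                ≡⟨ cong (λ c → (mulX s k + c * s k) * u k) (ℕ→ℚ-homo-+ n m) ⟩
    (mulX s k + (ℕ→ℚ n + ℕ→ℚ m) * s k) * u k
      ≡⟨ solve 5 (λ p a c x v → (p :+ (a :+ c) :* x) :* v := (p :+ (c :- con 1ℚ) :* x) :* v :+ (con 1ℚ :+ a) :* (x :* v))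
           refl (mulX s k) (ℕ→ℚ n) (ℕ→ℚ m) (s k) (u k) ⟩
    q k * u k + (1ℚ + ℕ→ℚ n) * (s k * u k)                ≡⟨ cong (λ c → q k * u k + c * (s k * u k)) (sym (ℕ→ℚ-suc n)) ⟩
    q k * u k + ℕ→ℚ (suc n) * (s k * u k)                 ∎

  viaSplit : ∑[ k < suc (suc n) ] (S₁ m (suc n) k * u k) ≡ Q + ℕ→ℚ (suc n) * ∑[ k < suc n ] (s k * u k)
  viaSplit = begin
    ∑[ k < suc (suc n) ] (S₁ m (suc n) k * u k)
      ≡⟨ trans (∑-cong (suc (suc n)) split) (∑-distrib-+ (suc (suc n)) _ _) ⟩
    Q + ∑[ k < suc (suc n) ] (ℕ→ℚ (suc n) * (s k * u k))
      ≡⟨ cong (_+_ Q) (∑-*ˡ (suc (suc n)) (ℕ→ℚ (suc n)) (λ k → s k * u k)) ⟩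
    Q + ℕ→ℚ (suc n) * (∑[ k < suc n ] (s k * u k) + s (suc n) * u (suc n))
      ≡⟨ cong (λ t → Q + ℕ→ℚ (suc n) * (∑[ k < suc n ] (s k * u k) + t * u (suc n))) (S₁-above m n) ⟩
    Q + ℕ→ℚ (suc n) * (∑[ k < suc n ] (s k * u k) + 0ℚ * u (suc n))
      ≡⟨ cong (λ t → Q + ℕ→ℚ (suc n) * t) (trans (cong (_+_ (∑[ k < suc n ] (s k * u k))) (*-zeroˡ (u (suc n)))) (+-identityʳ (∑[ k < suc n ] (s k * u k)))) ⟩
    Q + ℕ→ℚ (suc n) * ∑[ k < suc n ] (s k * u k) ∎

  shift-q : ∀ j → taylorShift (suc (suc n)) q j ≡ S₁ m (suc n) j
  shift-q j = begin
    taylorShift (suc (suc n)) q j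
      ≡⟨ taylorShift-linearFactor (suc n) s b j (S₁-above m n) ⟩
    mulX (taylorShift (suc n) s) j + (1ℚ + b) * taylorShift (suc n) s j
      ≡⟨ cong₂ (λ u v → u + (1ℚ + b) * v) (mulX-cong (S₁-taylorShift m n) j) (S₁-taylorShift m n j) ⟩
    mulX (S₁ (suc m) n) j + (1ℚ + b) * S₁ (suc m) n j
      ≡⟨ cong (λ c → mulX (S₁ (suc m) n) j + c * S₁ (suc m) n j) (solve 1 (λ c → con 1ℚ :+ (c :- con 1ℚ) := c) refl (ℕ→ℚ m)) ⟩
    mulX (S₁ (suc m) n) j + ℕ→ℚ m * S₁ (suc m) n j
      ≡⟨ sym (S₁-peel m n j) ⟩
    S₁ m (suc n) j ∎

  derivative-q : ∑[ k < suc (suc n) ] (q k * pow′ y k) ≡ rising′ (y + ℕ→ℚ m - 1ℚ) (suc n)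
  derivative-q = begin
    ∑[ k < suc (suc n) ] (q k * pow′ y k)
      ≡⟨ ∑-linearFactor (suc n) s q (λ _ → b) (pow′ y) (y ^ℚ_) (y + ℕ→ℚ m - 1ℚ) (S₁-above m n) (λ _ → refl)
           (λ k → solve 4 (λ y c p p′ → p :+ y :* p′ :+ (c :- con 1ℚ) :* p′ := (y :+ c :- con 1ℚ) :* p′ :+ p) refl y (ℕ→ℚ m) (y ^ℚ k) (pow′ y k)) ⟩
    (y + ℕ→ℚ m - 1ℚ) * ∑[ k < suc n ] (s k * pow′ y k) + ∑[ k < suc n ] (s k * y ^ℚ k)
      ≡⟨ cong₂ (λ u v → (y + ℕ→ℚ m - 1ℚ) * u + v) (∑-S₁-pow′ y m n) (∑-S₁-pow y m n) ⟩
    (y + ℕ→ℚ m - 1ℚ) * rising′ (y + ℕ→ℚ m) n + rising (y + ℕ→ℚ m) n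
      ≡⟨ +-comm ((y + ℕ→ℚ m - 1ℚ) * rising′ (y + ℕ→ℚ m) n) (rising (y + ℕ→ℚ m) n) ⟩
    rising (y + ℕ→ℚ m) n + (y + ℕ→ℚ m - 1ℚ) * rising′ (y + ℕ→ℚ m) n
      ≡⟨ cong (λ t → rising t n + (y + ℕ→ℚ m - 1ℚ) * rising′ t n) (solve 2 (λ y c → y :+ c := y :+ c :- con 1ℚ :+ con 1ℚ) refl y (ℕ→ℚ m)) ⟩
    rising (y + ℕ→ℚ m - 1ℚ + 1ℚ) n + (y + ℕ→ℚ m - 1ℚ) * rising′ (y + ℕ→ℚ m - 1ℚ + 1ℚ) n
      ≡⟨ sym (rising′-peel (y + ℕ→ℚ m - 1ℚ) n) ⟩
    rising′ (y + ℕ→ℚ m - 1ℚ) (suc n) ∎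

  viaShift : ∑[ k < suc (suc n) ] (S₁ m (suc n) k * u k) ≡ Q + rising′ (y + ℕ→ℚ m - 1ℚ) (suc n)
  viaShift = begin
    ∑[ j < suc (suc n) ] (S₁ m (suc n) j * u j)
      ≡⟨ ∑-cong (suc (suc n)) (λ j → cong (_* u j) (sym (shift-q j))) ⟩
    ∑[ j < suc (suc n) ] (taylorShift (suc (suc n)) q j * u j)
      ≡⟨ ∑-taylorShift (suc (suc n)) q u ⟩
    ∑[ k < suc (suc n) ] (q k * ∑[ j < suc k ] (ℕ→ℚ (k C j) * u j))
      ≡⟨ ∑-cong (suc (suc n)) (λ k → trans (cong (q k *_) (bernoulliPoly-difference y k)) (*-distribˡ-+ (q k) (u k) (pow′ y k))) ⟩
    ∑[ k < suc (suc n) ] (q k * u k + q k * pow′ y k)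
      ≡⟨ ∑-distrib-+ (suc (suc n)) (λ k → q k * u k) (λ k → q k * pow′ y k) ⟩
    Q + ∑[ k < suc (suc n) ] (q k * pow′ y k)
      ≡⟨ cong (_+_ Q) derivative-q ⟩
    Q + rising′ (y + ℕ→ℚ m - 1ℚ) (suc n) ∎

∑-S₂-bernoulliPoly : ∀ y (a : ℕ → ℚ) → (∀ k → ℕ→ℚ (suc k) * a k ≡ falling′ y (suc k)) →
  ∀ m n → ∑[ k < suc n ] (S₂ m n k * a k) ≡ bernoulliPoly n (y + ℕ→ℚ m)
∑-S₂-bernoulliPoly y a a-spec m = bernoulliPoly-unique (y + ℕ→ℚ m) (L m) recurrence
  where
  -- L m n = μ((x + m)^n), for the functional μ taking the values a on the falling-factorial basis
  L : ℕ → ℕ → ℚ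
  L m n = ∑[ k < suc n ] (S₂ m n k * a k)

  L-extend : ∀ m {j N} → j ℕ.≤ N → L m j ≡ ∑[ k < suc N ] (S₂ m j k * a k)
  L-extend m {j} j≤N = sym (∑-tail-zero (λ k → S₂ m j k * a k) (s≤s j≤N)
    (λ k j<k → trans (cong (λ t → ℕ→ℚ t * a k) (rStirling2-above m j<k)) (*-zeroˡ (a k))))

  L-binomial : ∀ m N → ∑[ j < suc N ] (ℕ→ℚ (N C j) * L m j) ≡ L (suc m) N
  L-binomial m N = begin
    ∑[ j < suc N ] (ℕ→ℚ (N C j) * L m j)
      ≡⟨ ∑-cong< (suc N) (λ j j<1+N → cong (ℕ→ℚ (N C j) *_) (L-extend m (ℕ.m<1+n⇒m≤n j<1+N))) ⟩
    ∑[ j < suc N ] (ℕ→ℚ (N C j) * ∑[ k < suc N ] (S₂ m j k * a k))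
      ≡⟨ ∑-cong (suc N) (λ j → trans (sym (∑-*ˡ (suc N) (ℕ→ℚ (N C j)) (λ k → S₂ m j k * a k)))
                                     (∑-cong (suc N) (λ k → sym (*-assoc (ℕ→ℚ (N C j)) (S₂ m j k) (a k))))) ⟩
    ∑[ j < suc N ] ∑[ k < suc N ] (ℕ→ℚ (N C j) * S₂ m j k * a k)
      ≡⟨ ∑-swap (suc N) (suc N) (λ j k → ℕ→ℚ (N C j) * S₂ m j k * a k) ⟩
    ∑[ k < suc N ] ∑[ j < suc N ] (ℕ→ℚ (N C j) * S₂ m j k * a k)
      ≡⟨ ∑-cong (suc N) (λ k → trans (∑-*ʳ (suc N) (a k) (λ j → ℕ→ℚ (N C j) * S₂ m j k))
                                     (cong (_* a k) (sym (S₂-binomial m N k)))) ⟩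
    L (suc m) N ∎

  L-param-suc : ∀ m N → L (suc m) N ≡ L m N + ∑[ k < suc N ] (S₂ m N k * falling′ y k)
  L-param-suc m N = begin
    ∑[ k < suc N ] (S₂ (suc m) N k * a k)
      ≡⟨ ∑-cong (suc N) (λ k → trans (cong (_* a k) (S₂-param-suc m N k)) (regroup k)) ⟩
    ∑[ k < suc N ] (S₂ m N k * a k + S₂ m N (suc k) * (ℕ→ℚ (suc k) * a k))
      ≡⟨ ∑-distrib-+ (suc N) (λ k → S₂ m N k * a k) (λ k → S₂ m N (suc k) * (ℕ→ℚ (suc k) * a k)) ⟩
    L m N + ∑[ k < suc N ] (S₂ m N (suc k) * (ℕ→ℚ (suc k) * a k))
      ≡⟨ cong (_+_ (L m N)) (∑-cong (suc N) (λ k → cong (S₂ m N (suc k) *_) (a-spec k))) ⟩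
    L m N + ∑[ k < suc N ] (S₂ m N (suc k) * falling′ y (suc k))
      ≡⟨ cong (_+_ (L m N)) (∑-rotate (suc N) (λ k → S₂ m N k * falling′ y k)
           (trans (*-zeroʳ (S₂ m N 0)) (sym (trans (cong (_* falling′ y (suc N)) (S₂-above m N)) (*-zeroˡ (falling′ y (suc N))))))) ⟩
    L m N + ∑[ k < suc N ] (S₂ m N k * falling′ y k) ∎
    where
    regroup : ∀ k → (S₂ m N k + ℕ→ℚ (suc k) * S₂ m N (suc k)) * a k ≡ S₂ m N k * a k + S₂ m N (suc k) * (ℕ→ℚ (suc k) * a k)
    regroup k = solve 4 (λ s c t x → (s :+ c :* t) :* x := s :* x :+ t :* (c :* x)) refl (S₂ m N k) (ℕ→ℚ (suc k)) (S₂ m N (suc k)) (a k)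

  recurrence : ∀ n → ∑[ j < suc n ] (ℕ→ℚ (suc n C j) * L m j) ≡ pow′ (y + ℕ→ℚ m) (suc n)
  recurrence n = +-cancelʳ (L m (suc n)) _ _ (begin
    ∑[ j < suc n ] (ℕ→ℚ (suc n C j) * L m j) + L m (suc n)
      ≡⟨ cong (_+_ (∑[ j < suc n ] (ℕ→ℚ (suc n C j) * L m j))) (sym (trans (cong (λ c → ℕ→ℚ c * L m (suc n)) (nCn≡1 (suc n))) (*-identityˡ _))) ⟩
    ∑[ j < suc (suc n) ] (ℕ→ℚ (suc n C j) * L m j)
      ≡⟨ L-binomial m (suc n) ⟩
    L (suc m) (suc n)
      ≡⟨ L-param-suc m (suc n) ⟩
    L m (suc n) + ∑[ k < suc (suc n) ] (S₂ m (suc n) k * falling′ y k)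
      ≡⟨ cong (_+_ (L m (suc n))) (∑-S₂-falling′ y m (suc n)) ⟩
    L m (suc n) + pow′ (y + ℕ→ℚ m) (suc n)
      ≡⟨ +-comm (L m (suc n)) (pow′ (y + ℕ→ℚ m) (suc n)) ⟩
    pow′ (y + ℕ→ℚ m) (suc n) + L m (suc n) ∎)

mainTheorem2 : (n r m : ℕ) →
    (sumTo n (λ k → sgn k * ℕ→ℚ (rStirling2 m n k) * ℕ→ℚ (k !) * hyperharmonic (suc k) (+ r))
      ≡ bernoulliPoly n (ℤ→ℚ (+ m -ℤ + r)))
    × (sumTo n (λ k → ℕ→ℚ (rStirling1 m n k) * bernoulliPoly k (ℕ→ℚ r))
      ≡ ℕ→ℚ (n !) * hyperharmonic (suc n) (+ r +ℤ + m -ℤ + 1))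
mainTheorem2 n r m = stirling2-side , stirling1-side
  where
  stirling2-side : sumTo n (λ k → sgn k * ℕ→ℚ (rStirling2 m n k) * ℕ→ℚ (k !) * hyperharmonic (suc k) (+ r))
                 ≡ bernoulliPoly n (ℤ→ℚ (+ m -ℤ + r))
  stirling2-side = begin
    sumTo n (λ k → sgn k * S₂ m n k * ℕ→ℚ (k !) * hyperharmonic (suc k) (+ r))
      ≡⟨ sumTo≡∑ n _ ⟩
    ∑[ k < suc n ] (sgn k * S₂ m n k * ℕ→ℚ (k !) * hyperharmonic (suc k) (+ r))
      ≡⟨ ∑-cong (suc n) (λ k → solve 4 (λ s x f h → s :* x :* f :* h := x :* (s :* f :* h)) refl
                                   (sgn k) (S₂ m n k) (ℕ→ℚ (k !)) (hyperharmonic (suc k) (+ r))) ⟩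
    ∑[ k < suc n ] (S₂ m n k * (sgn k * ℕ→ℚ (k !) * hyperharmonic (suc k) (+ r)))
      ≡⟨ ∑-S₂-bernoulliPoly (- ℕ→ℚ r) (λ k → sgn k * ℕ→ℚ (k !) * hyperharmonic (suc k) (+ r)) (falling′-neg-hyperharmonic r) m n ⟩
    bernoulliPoly n (- ℕ→ℚ r + ℕ→ℚ m)
      ≡⟨ cong (bernoulliPoly n) (trans (+-comm (- ℕ→ℚ r) (ℕ→ℚ m)) (sym (ℤ→ℚ-homo-sub (+ m) (+ r)))) ⟩
    bernoulliPoly n (ℤ→ℚ (+ m -ℤ + r)) ∎

  stirling1-side : sumTo n (λ k → ℕ→ℚ (rStirling1 m n k) * bernoulliPoly k (ℕ→ℚ r))
                 ≡ ℕ→ℚ (n !) * hyperharmonic (suc n) (+ r +ℤ + m -ℤ + 1)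
  stirling1-side = ℕ→ℚ-*-cancelˡ (suc n) (begin
    ℕ→ℚ (suc n) * sumTo n (λ k → S₁ m n k * bernoulliPoly k (ℕ→ℚ r))
      ≡⟨ cong (ℕ→ℚ (suc n) *_) (sumTo≡∑ n _) ⟩
    ℕ→ℚ (suc n) * ∑[ k < suc n ] (S₁ m n k * bernoulliPoly k (ℕ→ℚ r))
      ≡⟨ ∑-S₁-bernoulliPoly (ℕ→ℚ r) m n ⟩
    rising′ (ℕ→ℚ r + ℕ→ℚ m - 1ℚ) (suc n)
      ≡⟨ cong (λ z → rising′ z (suc n)) (sym (trans (ℤ→ℚ-homo-sub (+ r +ℤ + m) (+ 1)) (cong (_- 1ℚ) (ℤ→ℚ-homo-+ (+ r) (+ m))))) ⟩
    rising′ (ℤ→ℚ (+ r +ℤ + m -ℤ + 1)) (suc n)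
      ≡⟨ sym (factorial-hyperharmonic (+ r +ℤ + m -ℤ + 1) (suc n)) ⟩
    ℕ→ℚ (suc n !) * h
      ≡⟨ cong (_* h) (ℕ→ℚ-homo-* (suc n) (n !)) ⟩
    ℕ→ℚ (suc n) * ℕ→ℚ (n !) * h
      ≡⟨ *-assoc (ℕ→ℚ (suc n)) (ℕ→ℚ (n !)) h ⟩
    ℕ→ℚ (suc n) * (ℕ→ℚ (n !) * h) ∎)
    where h = hyperharmonic (suc n) (+ r +ℤ + m -ℤ + 1)
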